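{- For any $\Sigma_0$-formula $\varphi(x_1,\dots,x_n)$ with free variables among $x_1,\dots,x_n$ and any $1\le i\le n$, there is a term $\mathcal G_\varphi$ of $n$ arguments built (by composition) from the fundamental operations such that \[ \mathsf{IKP}^{ -\mathrm{Inf}}\vdash \mathcal G_\varphi(a,x_1,\dots,x_{i-1},x_{i+1},\dots,x_n)=\{x_i\in a:\varphi(x_1,\dots,x_n)\}. \]
   Context: $\mathsf{IKP}^{ -\mathrm{Inf}}$ is the theory with intuitionistic logic whose axioms are Extensionality, Empty Set, Pairing, Unions, Set Induction scheme, $\Sigma_0$-Separation scheme and $\Sigma_0$-Collection scheme (no axiom of infinity). $\langle a,b\rangle=\{\{a\},\{a,b\}\}$, $\langle a,b,c\rangle=\langle a,\langle b,c\rangle\rangle$; $1^{st}(x)=a$, $2^{nd}(x)=b$ when $x=\langle a,b\rangle$. The fundamental operations are the binary operations: $\{x,y\}$; $x\cap\bigcap y$; $\bigcup x$; $x\setminus y$; $x\times y$; $x\cap\{z: y\text{ is an ordered pair}\wedge(z\in 1^{st}(y)\to z\in 2^{nd}(y))\}$; $\{\{u:\langle z,u\rangle\in x\}:z\in y\}$; $\mathrm{dom}(x)=\{1^{st}(z):z\in x,\ z\text{ an ordered pair}\}$; $\mathrm{ran}(x)=\{2^{nd}(z):z\in x,\ z\text{ an ordered pair}\}$; $\{\langle u,v,w\rangle:\langle u,v\rangle\in x\wedge w\in y\}$; $\{\langle u,w,v\rangle:\langle u,v\rangle\in x\wedge w\in y\}$; $\{\langle v,u\rangle\in y\times x:u=v\}$;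 $\{\langle v,u\rangle\in y\times x:u\in v\}$. -}

module Defs where

-- Deep embedding of IKP^{-Inf} (intuitionistic first-order set theory, no Infinity),
-- extended by function symbols for the 13 fundamental operations together with their
-- defining axioms (a definitional extension), and an intuitionistic natural-deduction
-- calculus with primitive equality.

open import Data.Nat using (ℕ; zero; suc)
open import Data.Fin using (Fin; zero; suc; punchOut; _≟_)
open import Data.List using (List; []; _∷_; map)
open import Data.List.Membership.Propositional using (_∈_)
open import Relation.Nullary using (yes; no)

-- Fundamental operations (all binary; unary ones ignore their 2nd argument)

data Op : Set where
  upair     : Op
  capBigcap : Op   -- x ∩ ⋂ y
  bigUnion  : Op
  diff      : Op
  prod      : Op
  impSep    : Op   -- x ∩ {z : y ordered pair ∧ (z ∈ 1st y → z ∈ 2nd y)}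
  slices    : Op   -- {{u : ⟨z,u⟩ ∈ x} : z ∈ y}
  dom       : Op
  ran       : Op
  prodR3    : Op   -- {⟨u,v,w⟩ : ⟨u,v⟩ ∈ x ∧ w ∈ y}
  prodM3    : Op   -- {⟨u,w,v⟩ : ⟨u,v⟩ ∈ x ∧ w ∈ y}
  diagEq    : Op   -- {⟨v,u⟩ ∈ y × x : u = v}
  diagMem   : Op   -- {⟨v,u⟩ ∈ y × x : u ∈ v}

-- Syntax (scoped de Bruijn: Term n / Formula n have n free variables)

data Term (n : ℕ) : Set where
  var : Fin n → Term n
  app : Op → Term n → Term n → Term n

infix  7 _∈'_ _≐_
infixr 6 _∧'_
infixr 5 _∨'_
infixr 4 _⇒_ _⇔_

data Formula (n : ℕ) : Set where
  _∈'_ _≐_     : Term n → Term n → Formula n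
  ⊥'           : Formula n
  _∧'_ _∨'_ _⇒_ : Formula n → Formula n → Formula n
  ∀' ∃'        : Formula (suc n) → Formula n

¬'_ : ∀ {n} → Formula n → Formula n
¬' φ = φ ⇒ ⊥'

_⇔_ : ∀ {n} → Formula n → Formula n → Formula n
φ ⇔ ψ = (φ ⇒ ψ) ∧' (ψ ⇒ φ)

liftR : ∀ {m n} → (Fin m → Fin n) → Fin (suc m) → Fin (suc n)
liftR ρ zero    = zero
liftR ρ (suc i) = suc (ρ i)

renT : ∀ {m n} → (Fin m → Fin n) → Term m → Term n
renT ρ (var i)     = var (ρ i)
renT ρ (app o s t) = app o (renT ρ s) (renT ρ t)

ren : ∀ {m n} → (Fin m → Fin n) → Formula m → Formula n
ren ρ (s ∈' t) = renT ρ s ∈' renT ρ t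
ren ρ (s ≐ t)  = renT ρ s ≐ renT ρ t
ren ρ ⊥'       = ⊥'
ren ρ (φ ∧' ψ) = ren ρ φ ∧' ren ρ ψ
ren ρ (φ ∨' ψ) = ren ρ φ ∨' ren ρ ψ
ren ρ (φ ⇒ ψ)  = ren ρ φ ⇒ ren ρ ψ
ren ρ (∀' φ)   = ∀' (ren (liftR ρ) φ)
ren ρ (∃' φ)   = ∃' (ren (liftR ρ) φ)

suc² : ∀ {n} → Fin n → Fin (suc (suc n))
suc² i = suc (suc i)

↑ : ∀ {n} → Term n → Term (suc n)
↑ = renT suc

liftS : ∀ {m n} → (Fin m → Term n) → Fin (suc m) → Term (suc n)
liftS σ zero    = var zero
liftS σ (suc i) = ↑ (σ i)

subT : ∀ {m n} → (Fin m → Term n) → Term m → Term n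
subT σ (var i)     = σ i
subT σ (app o s t) = app o (subT σ s) (subT σ t)

sub : ∀ {m n} → (Fin m → Term n) → Formula m → Formula n
sub σ (s ∈' t) = subT σ s ∈' subT σ t
sub σ (s ≐ t)  = subT σ s ≐ subT σ t
sub σ ⊥'       = ⊥'
sub σ (φ ∧' ψ) = sub σ φ ∧' sub σ ψ
sub σ (φ ∨' ψ) = sub σ φ ∨' sub σ ψ
sub σ (φ ⇒ ψ)  = sub σ φ ⇒ sub σ ψ
sub σ (∀' φ)   = ∀' (sub (liftS σ) φ)
sub σ (∃' φ)   = ∃' (sub (liftS σ) φ)

inst : ∀ {n} → Formula (suc n) → Term n → Formula n
inst {n} φ t = sub σ φ
  where
  σ : Fin (suc n) → Term n
  σ zero    = t
  σ (suc i) = var i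

close : ∀ n → Formula n → Formula 0
close zero    φ = φ
close (suc n) φ = close n (∀' φ)

v0 : ∀ {n} → Term (suc n)
v0 = var zero
v1 : ∀ {n} → Term (suc (suc n))
v1 = var (suc zero)
v2 : ∀ {n} → Term (suc (suc (suc n)))
v2 = var (suc (suc zero))
v3 : ∀ {n} → Term (suc (suc (suc (suc n))))
v3 = var (suc (suc (suc zero)))

data IsPure {n : ℕ} : Formula n → Set where
  mem : (i j : Fin n) → IsPure (var i ∈' var j)
  eq  : (i j : Fin n) → IsPure (var i ≐ var j)
  bot : IsPure ⊥'
  and : ∀ {φ ψ} → IsPure φ → IsPure ψ → IsPure (φ ∧' ψ)
  or  : ∀ {φ ψ} → IsPure φ → IsPure ψ → IsPure (φ ∨' ψ)
  imp : ∀ {φ ψ} → IsPure φ → IsPure ψ → IsPure (φ ⇒ ψ)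
  all : ∀ {φ} → IsPure φ → IsPure (∀' φ)
  ex  : ∀ {φ} → IsPure φ → IsPure (∃' φ)

data IsΣ0 {n : ℕ} : Formula n → Set where
  mem  : (i j : Fin n) → IsΣ0 (var i ∈' var j)
  eq   : (i j : Fin n) → IsΣ0 (var i ≐ var j)
  bot  : IsΣ0 ⊥'
  and  : ∀ {φ ψ} → IsΣ0 φ → IsΣ0 ψ → IsΣ0 (φ ∧' ψ)
  or   : ∀ {φ ψ} → IsΣ0 φ → IsΣ0 ψ → IsΣ0 (φ ∨' ψ)
  imp  : ∀ {φ ψ} → IsΣ0 φ → IsΣ0 ψ → IsΣ0 (φ ⇒ ψ)
  ball : (j : Fin n) {φ : Formula (suc n)} → IsΣ0 φ → IsΣ0 (∀' (v0 ∈' var (suc j) ⇒ φ))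
  bex  : (j : Fin n) {φ : Formula (suc n)} → IsΣ0 φ → IsΣ0 (∃' (v0 ∈' var (suc j) ∧' φ))

opair : ∀ {n} → Term n → Term n → Term n
opair a b = app upair (app upair a a) (app upair a b)

triple : ∀ {n} → Term n → Term n → Term n → Term n
triple a b c = opair a (opair b c)

↑² : ∀ {n} → Term n → Term (suc (suc n))
↑² t = ↑ (↑ t)
↑³ : ∀ {n} → Term n → Term (suc (suc (suc n)))
↑³ t = ↑ (↑² t)

-- θ o x y z  :  "z ∈ o(x,y)"
θ : ∀ {n} → Op → Term n → Term n → Term n → Formula n
θ upair     x y z = z ≐ x ∨' z ≐ y
θ capBigcap x y z = z ∈' x ∧' ∀' (v0 ∈' ↑ y ⇒ ↑ z ∈' v0)
θ bigUnion  x y z = ∃' (v0 ∈' ↑ x ∧' ↑ z ∈' v0)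
θ diff      x y z = z ∈' x ∧' ¬' (z ∈' y)
θ prod      x y z = ∃' (∃' (v1 ∈' ↑² x ∧' v0 ∈' ↑² y ∧' ↑² z ≐ opair v1 v0))
θ impSep    x y z = z ∈' x ∧' ∃' (∃' (↑² y ≐ opair v1 v0 ∧' (↑² z ∈' v1 ⇒ ↑² z ∈' v0)))
θ slices    x y z = ∃' (v0 ∈' ↑ y ∧' ∀' (v0 ∈' ↑² z ⇔ opair v1 v0 ∈' ↑² x))
θ dom       x y z = ∃' (v0 ∈' ↑ x ∧' ∃' (v1 ≐ opair (↑² z) v0))
θ ran       x y z = ∃' (v0 ∈' ↑ x ∧' ∃' (v1 ≐ opair v0 (↑² z)))
θ prodR3    x y z = ∃' (∃' (∃' (opair v2 v1 ∈' ↑³ x ∧' v0 ∈' ↑³ y ∧' ↑³ z ≐ triple v2 v1 v0)))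
θ prodM3    x y z = ∃' (∃' (∃' (opair v2 v1 ∈' ↑³ x ∧' v0 ∈' ↑³ y ∧' ↑³ z ≐ triple v2 v0 v1)))
θ diagEq    x y z = ∃' (∃' (v1 ∈' ↑² y ∧' v0 ∈' ↑² x ∧' v0 ≐ v1 ∧' ↑² z ≐ opair v1 v0))
θ diagMem   x y z = ∃' (∃' (v1 ∈' ↑² y ∧' v0 ∈' ↑² x ∧' v0 ∈' v1 ∧' ↑² z ≐ opair v1 v0))

defAx : Op → Formula 0
defAx o = ∀' (∀' (∀' (v0 ∈' app o v2 v1 ⇔ θ o v2 v1 v0)))

extAx : Formula 0
extAx = ∀' (∀' (∀' (v0 ∈' v2 ⇔ v0 ∈' v1) ⇒ v1 ≐ v0))

emptyAx : Formula 0
emptyAx = ∃' (∀' (¬' (v0 ∈' v1)))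

pairAx : Formula 0
pairAx = ∀' (∀' (∃' (v2 ∈' v0 ∧' v1 ∈' v0)))

unionAx : Formula 0
unionAx = ∀' (∃' (∀' (v0 ∈' v2 ⇒ ∀' (v0 ∈' v1 ⇒ v0 ∈' v2))))

-- φ(x, params), var 0 = x :  ∀x(∀y∈x φ(y) → φ(x)) → ∀x φ(x)
indF : ∀ {n} → Formula (suc n) → Formula n
indF φ = ∀' (∀' (v0 ∈' v1 ⇒ ren (liftR suc) φ) ⇒ φ) ⇒ ∀' φ

-- φ(x, params), var 0 = x :  ∀a ∃y ∀x (x ∈ y ↔ x ∈ a ∧ φ(x))
sepF : ∀ {n} → Formula (suc n) → Formula n
sepF φ = ∀' (∃' (∀' (v0 ∈' v1 ⇔ v0 ∈' v2 ∧' ren (liftR suc²) φ)))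

-- φ(y, x, params), var 0 = y, var 1 = x :
--   ∀a (∀x∈a ∃y φ(x,y) → ∃b ∀x∈a ∃y∈b φ(x,y))
collF : ∀ {n} → Formula (suc (suc n)) → Formula n
collF φ = ∀' ( ∀' (v0 ∈' v1 ⇒ ∃' (ren (liftR (liftR suc)) φ))
             ⇒ ∃' (∀' (v0 ∈' v2 ⇒ ∃' (v0 ∈' v2 ∧' ren (liftR (liftR suc²)) φ))))

data Axiom : Formula 0 → Set where
  extensionality : Axiom extAx
  emptySet       : Axiom emptyAx
  pairing        : Axiom pairAx
  unions         : Axiom unionAx
  setInduction   : ∀ {n} (φ : Formula (suc n)) → IsPure φ → Axiom (close n (indF φ))
  Σ0-separation  : ∀ {n} (φ : Formula (suc n)) → IsΣ0 φ → Axiom (close n (sepF φ))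
  Σ0-collection  : ∀ {n} (φ : Formula (suc (suc n))) → IsΣ0 φ → Axiom (close n (collF φ))
  definition     : (o : Op) → Axiom (defAx o)

wkCtx : ∀ {n} → List (Formula n) → List (Formula (suc n))
wkCtx = map (ren suc)

infix 2 _⊢_

data _⊢_ : {n : ℕ} → List (Formula n) → Formula n → Set where
  hyp  : ∀ {n} {Γ : List (Formula n)} {φ} → φ ∈ Γ → Γ ⊢ φ
  ax   : ∀ {n} {Γ : List (Formula n)} {φ} → Axiom φ → Γ ⊢ ren (λ ()) φ
  ⊥E   : ∀ {n} {Γ : List (Formula n)} {φ} → Γ ⊢ ⊥' → Γ ⊢ φ
  ∧I   : ∀ {n} {Γ : List (Formula n)} {φ ψ} → Γ ⊢ φ → Γ ⊢ ψ → Γ ⊢ φ ∧' ψ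
  ∧E₁  : ∀ {n} {Γ : List (Formula n)} {φ ψ} → Γ ⊢ φ ∧' ψ → Γ ⊢ φ
  ∧E₂  : ∀ {n} {Γ : List (Formula n)} {φ ψ} → Γ ⊢ φ ∧' ψ → Γ ⊢ ψ
  ∨I₁  : ∀ {n} {Γ : List (Formula n)} {φ ψ} → Γ ⊢ φ → Γ ⊢ φ ∨' ψ
  ∨I₂  : ∀ {n} {Γ : List (Formula n)} {φ ψ} → Γ ⊢ ψ → Γ ⊢ φ ∨' ψ
  ∨E   : ∀ {n} {Γ : List (Formula n)} {φ ψ χ} →
         Γ ⊢ φ ∨' ψ → (φ ∷ Γ) ⊢ χ → (ψ ∷ Γ) ⊢ χ → Γ ⊢ χ
  ⇒I   : ∀ {n} {Γ : List (Formula n)} {φ ψ} → (φ ∷ Γ) ⊢ ψ → Γ ⊢ φ ⇒ ψ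
  ⇒E   : ∀ {n} {Γ : List (Formula n)} {φ ψ} → Γ ⊢ φ ⇒ ψ → Γ ⊢ φ → Γ ⊢ ψ
  ∀I   : ∀ {n} {Γ : List (Formula n)} {φ} → wkCtx Γ ⊢ φ → Γ ⊢ ∀' φ
  ∀E   : ∀ {n} {Γ : List (Formula n)} {φ} → Γ ⊢ ∀' φ → (t : Term n) → Γ ⊢ inst φ t
  ∃I   : ∀ {n} {Γ : List (Formula n)} {φ} (t : Term n) → Γ ⊢ inst φ t → Γ ⊢ ∃' φ
  ∃E   : ∀ {n} {Γ : List (Formula n)} {φ ψ} →
         Γ ⊢ ∃' φ → (φ ∷ wkCtx Γ) ⊢ ren suc ψ → Γ ⊢ ψ
  =I   : ∀ {n} {Γ : List (Formula n)} (t : Term n) → Γ ⊢ t ≐ t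
  =E   : ∀ {n} {Γ : List (Formula n)} (φ : Formula (suc n)) {s t : Term n} →
         Γ ⊢ s ≐ t → Γ ⊢ inst φ s → Γ ⊢ inst φ t

⊢IKP : ∀ {n} → Formula n → Set
⊢IKP φ = [] ⊢ φ

-- Outer scope (suc m): var 0 = a, var (suc k) = the k-th of x_1..x_n with x_i omitted.
-- Under one more binder z: var 0 = z, var 1 = a, var (2+k) = k-th remaining x.
-- φ's variable j (j = x_{j}) is sent to z if j = i and to the matching remaining x otherwise.
sepRen : ∀ {m} → Fin (suc m) → Fin (suc m) → Fin (suc (suc m))
sepRen i j with i ≟ j
... | yes _  = zero
... | no i≢j = suc (suc (punchOut i≢j))

-- "G(a, x_1,...,x̂_i,...,x_n) = {x_i ∈ a : φ(x_1,...,x_n)}", i.e.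
-- ∀z (z ∈ G(a,...) ↔ z ∈ a ∧ φ(x_1,...,x_{i-1},z,x_{i+1},...,x_n))
SepEq : ∀ {m} → Term (suc m) → Formula (suc m) → Fin (suc m) → Formula (suc m)
SepEq G φ i = ∀' (v0 ∈' ↑ G ⇔ v0 ∈' v1 ∧' ren (sepRen i) φ)

{-# OPTIONS --safe #-}

-- The term is built by recursion on the Σ₀ formula, for any number k + 1 of variables
-- packed into a tuple τ = ⟨x₀,⟨x₁,…,x_k⟩⟩ that ranges over a domain set D: one constructs T
-- with  τ ∈ T ↔ τ ∈ D ∧ φ(τ).  Connectives become ∩, ∪, D ∖ D and impSep.  An atom xᵢ ∈ xⱼ
-- or xᵢ = xⱼ is cut out by a diagonal operation from the graphs {⟨xⱼ,τ⟩ : τ ∈ D} of the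
-- coordinate projections, which dom, ran, prodR3 and prodM3 produce by recursion on k.
-- A bounded quantifier over y ∈ xⱼ makes y a new tuple coordinate with domain
-- (⋃ dom graphⱼ) × D, which contains every such y, and is then removed by slices and ⋂
-- (for ∀) or by ran (for ∃).  The theorem is the case k = 0 after moving xᵢ to the front.

module Submission where

open import Defs
open import Data.Nat using (ℕ; zero; suc; _+_)
open import Data.Fin using (Fin; zero; suc; punchOut; _≟_; #_; _↑ʳ_)
open import Data.Vec using ([]; _∷_; lookup)
open import Data.List using (List; []; _∷_)
open import Data.List.Membership.Propositional using (_∈_)
open import Data.List.Membership.Propositional.Properties using (∈-map⁺; ∈-map⁻)
open import Data.List.Relation.Unary.Any using (here; there)
open import Data.Product using (Σ-syntax; _,_)
open import Function using (_∘_; id)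
open import Relation.Nullary using (yes; no)
open import Relation.Binary.PropositionalEquality
  using (_≡_; refl; sym; trans; cong; cong₂; subst; subst₂; module ≡-Reasoning)

private
  variable
    l m n : ℕ

renT-∘ : (ρ : Fin m → Fin n) (ρ′ : Fin l → Fin m) (t : Term l) →
         renT ρ (renT ρ′ t) ≡ renT (ρ ∘ ρ′) t
renT-∘ ρ ρ′ (var i)     = refl
renT-∘ ρ ρ′ (app o s t) = cong₂ (app o) (renT-∘ ρ ρ′ s) (renT-∘ ρ ρ′ t)

renT-wk : (ρ : Fin m → Fin n) (t : Term m) → renT (liftR ρ) (↑ t) ≡ ↑ (renT ρ t)
renT-wk ρ t = trans (renT-∘ (liftR ρ) suc t) (sym (renT-∘ suc ρ t))

renT-as-subT : (ρ : Fin m → Fin n) (t : Term m) → renT ρ t ≡ subT (var ∘ ρ) t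
renT-as-subT ρ (var i)     = refl
renT-as-subT ρ (app o s t) = cong₂ (app o) (renT-as-subT ρ s) (renT-as-subT ρ t)

subT-id : (t : Term n) → subT var t ≡ t
subT-id (var i)     = refl
subT-id (app o s t) = cong₂ (app o) (subT-id s) (subT-id t)

renT-id : (t : Term n) → renT id t ≡ t
renT-id t = trans (renT-as-subT id t) (subT-id t)

subT-cong : {σ σ′ : Fin m → Term n} → (∀ i → σ i ≡ σ′ i) → ∀ t → subT σ t ≡ subT σ′ t
subT-cong e (var i)     = e i
subT-cong e (app o s t) = cong₂ (app o) (subT-cong e s) (subT-cong e t)

subT-renT : (σ : Fin m → Term n) (ρ : Fin l → Fin m) (t : Term l) →
            subT σ (renT ρ t) ≡ subT (σ ∘ ρ) t
subT-renT σ ρ (var i)     = refl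
subT-renT σ ρ (app o s t) = cong₂ (app o) (subT-renT σ ρ s) (subT-renT σ ρ t)

renT-subT : (ρ : Fin m → Fin n) (σ : Fin l → Term m) (t : Term l) →
            renT ρ (subT σ t) ≡ subT (renT ρ ∘ σ) t
renT-subT ρ σ (var i)     = refl
renT-subT ρ σ (app o s t) = cong₂ (app o) (renT-subT ρ σ s) (renT-subT ρ σ t)

subT-subT : (σ : Fin m → Term n) (τ : Fin l → Term m) (t : Term l) →
            subT σ (subT τ t) ≡ subT (subT σ ∘ τ) t
subT-subT σ τ (var i)     = refl
subT-subT σ τ (app o s t) = cong₂ (app o) (subT-subT σ τ s) (subT-subT σ τ t)

liftS-cong : {σ σ′ : Fin m → Term n} → (∀ i → σ i ≡ σ′ i) → ∀ i → liftS σ i ≡ liftS σ′ i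
liftS-cong e zero    = refl
liftS-cong e (suc i) = cong ↑ (e i)

sub-cong : {σ σ′ : Fin m → Term n} → (∀ i → σ i ≡ σ′ i) → ∀ φ → sub σ φ ≡ sub σ′ φ
sub-cong e (s ∈' t) = cong₂ _∈'_ (subT-cong e s) (subT-cong e t)
sub-cong e (s ≐ t)  = cong₂ _≐_ (subT-cong e s) (subT-cong e t)
sub-cong e ⊥'       = refl
sub-cong e (φ ∧' ψ) = cong₂ _∧'_ (sub-cong e φ) (sub-cong e ψ)
sub-cong e (φ ∨' ψ) = cong₂ _∨'_ (sub-cong e φ) (sub-cong e ψ)
sub-cong e (φ ⇒ ψ)  = cong₂ _⇒_ (sub-cong e φ) (sub-cong e ψ)
sub-cong e (∀' φ)   = cong ∀' (sub-cong (liftS-cong e) φ)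
sub-cong e (∃' φ)   = cong ∃' (sub-cong (liftS-cong e) φ)

liftS-var : ∀ (i : Fin (suc n)) → liftS var i ≡ var i
liftS-var zero    = refl
liftS-var (suc i) = refl

sub-id : (φ : Formula n) → sub var φ ≡ φ
sub-id (s ∈' t) = cong₂ _∈'_ (subT-id s) (subT-id t)
sub-id (s ≐ t)  = cong₂ _≐_ (subT-id s) (subT-id t)
sub-id ⊥'       = refl
sub-id (φ ∧' ψ) = cong₂ _∧'_ (sub-id φ) (sub-id ψ)
sub-id (φ ∨' ψ) = cong₂ _∨'_ (sub-id φ) (sub-id ψ)
sub-id (φ ⇒ ψ)  = cong₂ _⇒_ (sub-id φ) (sub-id ψ)
sub-id (∀' φ)   = cong ∀' (trans (sub-cong liftS-var φ) (sub-id φ))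
sub-id (∃' φ)   = cong ∃' (trans (sub-cong liftS-var φ) (sub-id φ))

liftS-var∘ : (ρ : Fin m → Fin n) (i : Fin (suc m)) → liftS (var ∘ ρ) i ≡ var (liftR ρ i)
liftS-var∘ ρ zero    = refl
liftS-var∘ ρ (suc i) = refl

ren-as-sub : (ρ : Fin m → Fin n) (φ : Formula m) → ren ρ φ ≡ sub (var ∘ ρ) φ
ren-as-sub ρ (s ∈' t) = cong₂ _∈'_ (renT-as-subT ρ s) (renT-as-subT ρ t)
ren-as-sub ρ (s ≐ t)  = cong₂ _≐_ (renT-as-subT ρ s) (renT-as-subT ρ t)
ren-as-sub ρ ⊥'       = refl
ren-as-sub ρ (φ ∧' ψ) = cong₂ _∧'_ (ren-as-sub ρ φ) (ren-as-sub ρ ψ)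
ren-as-sub ρ (φ ∨' ψ) = cong₂ _∨'_ (ren-as-sub ρ φ) (ren-as-sub ρ ψ)
ren-as-sub ρ (φ ⇒ ψ)  = cong₂ _⇒_ (ren-as-sub ρ φ) (ren-as-sub ρ ψ)
ren-as-sub ρ (∀' φ)   = cong ∀' (trans (ren-as-sub (liftR ρ) φ) (sym (sub-cong (liftS-var∘ ρ) φ)))
ren-as-sub ρ (∃' φ)   = cong ∃' (trans (ren-as-sub (liftR ρ) φ) (sym (sub-cong (liftS-var∘ ρ) φ)))

liftS-∘ : (σ : Fin m → Term n) (τ : Fin l → Term m) (i : Fin (suc l)) →
          subT (liftS σ) (liftS τ i) ≡ liftS (subT σ ∘ τ) i
liftS-∘ σ τ zero    = refl
liftS-∘ σ τ (suc i) = trans (subT-renT (liftS σ) suc (τ i)) (sym (renT-subT suc σ (τ i)))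

sub-sub : (σ : Fin m → Term n) (τ : Fin l → Term m) (φ : Formula l) →
          sub σ (sub τ φ) ≡ sub (subT σ ∘ τ) φ
sub-sub σ τ (s ∈' t) = cong₂ _∈'_ (subT-subT σ τ s) (subT-subT σ τ t)
sub-sub σ τ (s ≐ t)  = cong₂ _≐_ (subT-subT σ τ s) (subT-subT σ τ t)
sub-sub σ τ ⊥'       = refl
sub-sub σ τ (φ ∧' ψ) = cong₂ _∧'_ (sub-sub σ τ φ) (sub-sub σ τ ψ)
sub-sub σ τ (φ ∨' ψ) = cong₂ _∨'_ (sub-sub σ τ φ) (sub-sub σ τ ψ)
sub-sub σ τ (φ ⇒ ψ)  = cong₂ _⇒_ (sub-sub σ τ φ) (sub-sub σ τ ψ)
sub-sub σ τ (∀' φ)   = cong ∀' (trans (sub-sub (liftS σ) (liftS τ) φ) (sub-cong (liftS-∘ σ τ) φ))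
sub-sub σ τ (∃' φ)   = cong ∃' (trans (sub-sub (liftS σ) (liftS τ) φ) (sub-cong (liftS-∘ σ τ) φ))

sub-ren : (σ : Fin m → Term n) (ρ : Fin l → Fin m) (φ : Formula l) →
          sub σ (ren ρ φ) ≡ sub (σ ∘ ρ) φ
sub-ren σ ρ φ = trans (cong (sub σ) (ren-as-sub ρ φ)) (sub-sub σ (var ∘ ρ) φ)

ren-sub : (ρ : Fin m → Fin n) (σ : Fin l → Term m) (φ : Formula l) →
          ren ρ (sub σ φ) ≡ sub (renT ρ ∘ σ) φ
ren-sub ρ σ φ = begin
  ren ρ (sub σ φ)             ≡⟨ ren-as-sub ρ (sub σ φ) ⟩
  sub (var ∘ ρ) (sub σ φ)     ≡⟨ sub-sub (var ∘ ρ) σ φ ⟩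
  sub (subT (var ∘ ρ) ∘ σ) φ  ≡⟨ sub-cong (λ i → sym (renT-as-subT ρ (σ i))) φ ⟩
  sub (renT ρ ∘ σ) φ          ∎
  where open ≡-Reasoning

ren-∘ : (ρ : Fin m → Fin n) (ρ′ : Fin l → Fin m) (φ : Formula l) →
        ren ρ (ren ρ′ φ) ≡ ren (ρ ∘ ρ′) φ
ren-∘ ρ ρ′ φ = begin
  ren ρ (ren ρ′ φ)          ≡⟨ cong (ren ρ) (ren-as-sub ρ′ φ) ⟩
  ren ρ (sub (var ∘ ρ′) φ)  ≡⟨ ren-sub ρ (var ∘ ρ′) φ ⟩
  sub (var ∘ ρ ∘ ρ′) φ      ≡⟨ sym (ren-as-sub (ρ ∘ ρ′) φ) ⟩
  ren (ρ ∘ ρ′) φ            ∎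
  where open ≡-Reasoning

ren-cong : {ρ ρ′ : Fin m → Fin n} → (∀ i → ρ i ≡ ρ′ i) → ∀ φ → ren ρ φ ≡ ren ρ′ φ
ren-cong {ρ = ρ} {ρ′} e φ =
  trans (ren-as-sub ρ φ) (trans (sub-cong (cong var ∘ e) φ) (sym (ren-as-sub ρ′ φ)))

ren-id : (φ : Formula n) → ren id φ ≡ φ
ren-id φ = trans (ren-as-sub id φ) (sub-id φ)

instS : Term n → Fin (suc n) → Term n
instS t zero    = t
instS t (suc i) = var i

inst-as-sub : (φ : Formula (suc n)) (t : Term n) → inst φ t ≡ sub (instS t) φ
inst-as-sub φ t = sub-cong (λ { zero → refl ; (suc i) → refl }) φ

sub-inst : (σ : Fin m → Term n) (φ : Formula (suc m)) (t : Term m) →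
           sub σ (inst φ t) ≡ inst (sub (liftS σ) φ) (subT σ t)
sub-inst σ φ t = begin
  sub σ (inst φ t)                           ≡⟨ cong (sub σ) (inst-as-sub φ t) ⟩
  sub σ (sub (instS t) φ)                    ≡⟨ sub-sub σ (instS t) φ ⟩
  sub (subT σ ∘ instS t) φ                   ≡⟨ sub-cong pointwise φ ⟩
  sub (subT (instS (subT σ t)) ∘ liftS σ) φ  ≡⟨ sym (sub-sub (instS (subT σ t)) (liftS σ) φ) ⟩
  sub (instS (subT σ t)) (sub (liftS σ) φ)   ≡⟨ sym (inst-as-sub (sub (liftS σ) φ) (subT σ t)) ⟩
  inst (sub (liftS σ) φ) (subT σ t)          ∎
  where
  open ≡-Reasoning
  pointwise : ∀ i → subT σ (instS t i) ≡ subT (instS (subT σ t)) (liftS σ i)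
  pointwise zero    = refl
  pointwise (suc i) = sym (trans (subT-renT (instS (subT σ t)) suc (σ i)) (subT-id (σ i)))

ren-inst : (ρ : Fin m → Fin n) (φ : Formula (suc m)) (t : Term m) →
           ren ρ (inst φ t) ≡ inst (ren (liftR ρ) φ) (renT ρ t)
ren-inst ρ φ t = begin
  ren ρ (inst φ t)
    ≡⟨ ren-as-sub ρ (inst φ t) ⟩
  sub (var ∘ ρ) (inst φ t)
    ≡⟨ sub-inst (var ∘ ρ) φ t ⟩
  inst (sub (liftS (var ∘ ρ)) φ) (subT (var ∘ ρ) t)
    ≡⟨ cong₂ inst (sub-cong (liftS-var∘ ρ) φ) (sym (renT-as-subT ρ t)) ⟩
  inst (sub (var ∘ liftR ρ) φ) (renT ρ t)
    ≡⟨ cong (λ ψ → inst ψ (renT ρ t)) (sym (ren-as-sub (liftR ρ) φ)) ⟩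
  inst (ren (liftR ρ) φ) (renT ρ t)
    ∎
  where open ≡-Reasoning

ren-wk : (ρ : Fin m → Fin n) (φ : Formula m) → ren (liftR ρ) (ren suc φ) ≡ ren suc (ren ρ φ)
ren-wk ρ φ = trans (ren-∘ (liftR ρ) suc φ) (sym (ren-∘ suc ρ φ))

sub-wk : (σ : Fin m → Term n) (φ : Formula m) → sub (liftS σ) (ren suc φ) ≡ ren suc (sub σ φ)
sub-wk σ φ = trans (sub-ren (liftS σ) suc φ) (sym (ren-sub suc σ φ))

ren-closed : (ρ : Fin m → Fin n) (φ : Formula 0) → ren ρ (ren (λ ()) φ) ≡ ren (λ ()) φ
ren-closed ρ φ = trans (ren-∘ ρ (λ ()) φ) (ren-cong (λ ()) φ)

sub-closed : (σ : Fin m → Term n) (φ : Formula 0) → sub σ (ren (λ ()) φ) ≡ ren (λ ()) φ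
sub-closed σ φ = trans (sub-ren σ (λ ()) φ) (trans (sub-cong (λ ()) φ) (sym (ren-as-sub (λ ()) φ)))

private
  variable
    Γ Δ : List (Formula n)
    φ ψ χ : Formula n
    s t u : Term n

Renames : (Fin m → Fin n) → List (Formula m) → List (Formula n) → Set
Renames ρ Γ Δ = ∀ {ψ} → ψ ∈ Γ → ren ρ ψ ∈ Δ

renames-∷ : {ρ : Fin m → Fin n} → Renames ρ Γ Δ → Renames ρ (φ ∷ Γ) (ren ρ φ ∷ Δ)
renames-∷ h (here refl) = here refl
renames-∷ h (there p)   = there (h p)

renames-wkCtx : {ρ : Fin m → Fin n} → Renames ρ Γ Δ → Renames (liftR ρ) (wkCtx Γ) (wkCtx Δ)
renames-wkCtx {Δ = Δ} {ρ = ρ} h p with ∈-map⁻ (ren suc) p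
... | ψ , q , refl = subst (_∈ wkCtx Δ) (sym (ren-wk ρ ψ)) (∈-map⁺ (ren suc) (h q))

⊢-ren : Γ ⊢ φ → (ρ : Fin m → Fin n) → Renames ρ Γ Δ → Δ ⊢ ren ρ φ
⊢-ren (hyp p)      ρ h = hyp (h p)
⊢-ren {Δ = Δ} (ax {φ = φ} a) ρ h = subst (Δ ⊢_) (sym (ren-closed ρ φ)) (ax a)
⊢-ren (⊥E d)       ρ h = ⊥E (⊢-ren d ρ h)
⊢-ren (∧I d e)     ρ h = ∧I (⊢-ren d ρ h) (⊢-ren e ρ h)
⊢-ren (∧E₁ d)      ρ h = ∧E₁ (⊢-ren d ρ h)
⊢-ren (∧E₂ d)      ρ h = ∧E₂ (⊢-ren d ρ h)
⊢-ren (∨I₁ d)      ρ h = ∨I₁ (⊢-ren d ρ h)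
⊢-ren (∨I₂ d)      ρ h = ∨I₂ (⊢-ren d ρ h)
⊢-ren (∨E d e f)   ρ h = ∨E (⊢-ren d ρ h) (⊢-ren e ρ (renames-∷ h)) (⊢-ren f ρ (renames-∷ h))
⊢-ren (⇒I d)       ρ h = ⇒I (⊢-ren d ρ (renames-∷ h))
⊢-ren (⇒E d e)     ρ h = ⇒E (⊢-ren d ρ h) (⊢-ren e ρ h)
⊢-ren (∀I d)       ρ h = ∀I (⊢-ren d (liftR ρ) (renames-wkCtx h))
⊢-ren {Δ = Δ} (∀E {φ = φ} d t) ρ h =
  subst (Δ ⊢_) (sym (ren-inst ρ φ t)) (∀E (⊢-ren d ρ h) (renT ρ t))
⊢-ren {Δ = Δ} (∃I {φ = φ} t d) ρ h =
  ∃I (renT ρ t) (subst (Δ ⊢_) (ren-inst ρ φ t) (⊢-ren d ρ h))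
⊢-ren (∃E {ψ = ψ} d e) ρ h =
  ∃E (⊢-ren d ρ h) (subst (_ ⊢_) (ren-wk ρ ψ) (⊢-ren e (liftR ρ) (renames-∷ (renames-wkCtx h))))
⊢-ren (=I t)       ρ h = =I (renT ρ t)
⊢-ren {Δ = Δ} (=E φ {s} {t} d e) ρ h =
  subst (Δ ⊢_) (sym (ren-inst ρ φ t))
    (=E (ren (liftR ρ) φ) (⊢-ren d ρ h) (subst (Δ ⊢_) (ren-inst ρ φ s) (⊢-ren e ρ h)))

weaken : Γ ⊢ φ → (ψ ∷ Γ) ⊢ φ
weaken {Γ = Γ} {φ} {ψ} d =
  subst (ψ ∷ Γ ⊢_) (ren-id φ) (⊢-ren d id λ {χ} p → there (subst (_∈ Γ) (sym (ren-id χ)) p))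

weaken-[] : [] ⊢ φ → Γ ⊢ φ
weaken-[] {φ = φ} {Γ} d = subst (Γ ⊢_) (ren-id φ) (⊢-ren d id λ ())

⊢-wkVar : Γ ⊢ φ → wkCtx Γ ⊢ ren suc φ
⊢-wkVar d = ⊢-ren d suc (∈-map⁺ (ren suc))

Substitutes : (Fin m → Term n) → List (Formula m) → List (Formula n) → Set
Substitutes σ Γ Δ = ∀ {ψ} → ψ ∈ Γ → Δ ⊢ sub σ ψ

substitutes-∷ : {σ : Fin m → Term n} → Substitutes σ Γ Δ → Substitutes σ (φ ∷ Γ) (sub σ φ ∷ Δ)
substitutes-∷ h (here refl) = hyp (here refl)
substitutes-∷ h (there p)   = weaken (h p)

substitutes-wkCtx : {σ : Fin m → Term n} → Substitutes σ Γ Δ →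
                    Substitutes (liftS σ) (wkCtx Γ) (wkCtx Δ)
substitutes-wkCtx {Δ = Δ} {σ = σ} h p with ∈-map⁻ (ren suc) p
... | ψ , q , refl = subst (wkCtx Δ ⊢_) (sym (sub-wk σ ψ)) (⊢-wkVar (h q))

⊢-sub : Γ ⊢ φ → (σ : Fin m → Term n) → Substitutes σ Γ Δ → Δ ⊢ sub σ φ
⊢-sub (hyp p)      σ h = h p
⊢-sub {Δ = Δ} (ax {φ = φ} a) σ h = subst (Δ ⊢_) (sym (sub-closed σ φ)) (ax a)
⊢-sub (⊥E d)       σ h = ⊥E (⊢-sub d σ h)
⊢-sub (∧I d e)     σ h = ∧I (⊢-sub d σ h) (⊢-sub e σ h)
⊢-sub (∧E₁ d)      σ h = ∧E₁ (⊢-sub d σ h)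
⊢-sub (∧E₂ d)      σ h = ∧E₂ (⊢-sub d σ h)
⊢-sub (∨I₁ d)      σ h = ∨I₁ (⊢-sub d σ h)
⊢-sub (∨I₂ d)      σ h = ∨I₂ (⊢-sub d σ h)
⊢-sub (∨E d e f)   σ h = ∨E (⊢-sub d σ h) (⊢-sub e σ (substitutes-∷ h)) (⊢-sub f σ (substitutes-∷ h))
⊢-sub (⇒I d)       σ h = ⇒I (⊢-sub d σ (substitutes-∷ h))
⊢-sub (⇒E d e)     σ h = ⇒E (⊢-sub d σ h) (⊢-sub e σ h)
⊢-sub (∀I d)       σ h = ∀I (⊢-sub d (liftS σ) (substitutes-wkCtx h))
⊢-sub {Δ = Δ} (∀E {φ = φ} d t) σ h =
  subst (Δ ⊢_) (sym (sub-inst σ φ t)) (∀E (⊢-sub d σ h) (subT σ t))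
⊢-sub {Δ = Δ} (∃I {φ = φ} t d) σ h =
  ∃I (subT σ t) (subst (Δ ⊢_) (sub-inst σ φ t) (⊢-sub d σ h))
⊢-sub (∃E {ψ = ψ} d e) σ h =
  ∃E (⊢-sub d σ h) (subst (_ ⊢_) (sub-wk σ ψ) (⊢-sub e (liftS σ) (substitutes-∷ (substitutes-wkCtx h))))
⊢-sub (=I t)       σ h = =I (subT σ t)
⊢-sub {Δ = Δ} (=E φ {s} {t} d e) σ h =
  subst (Δ ⊢_) (sym (sub-inst σ φ t))
    (=E (sub (liftS σ) φ) (⊢-sub d σ h) (subst (Δ ⊢_) (sub-inst σ φ s) (⊢-sub e σ h)))

-- A schema is proved once for variables in the empty context, where weakening
-- and instantiation compute, and then instantiated with arbitrary terms.
instantiate : [] ⊢ φ → (σ : Fin m → Term n) → Γ ⊢ sub σ φ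
instantiate d σ = ⊢-sub d σ λ ()

hyp₀ : (φ ∷ Γ) ⊢ φ
hyp₀ = hyp (here refl)

hyp₁ : (ψ ∷ φ ∷ Γ) ⊢ φ
hyp₁ = hyp (there (here refl))

hyp₂ : (χ ∷ ψ ∷ φ ∷ Γ) ⊢ φ
hyp₂ = hyp (there (there (here refl)))

⇔I : (φ ∷ Γ) ⊢ ψ → (ψ ∷ Γ) ⊢ φ → Γ ⊢ φ ⇔ ψ
⇔I d e = ∧I (⇒I d) (⇒I e)

⇔-to : Γ ⊢ φ ⇔ ψ → Γ ⊢ φ → Γ ⊢ ψ
⇔-to d = ⇒E (∧E₁ d)

⇔-from : Γ ⊢ φ ⇔ ψ → Γ ⊢ ψ → Γ ⊢ φ
⇔-from d = ⇒E (∧E₂ d)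

⇔-trans : Γ ⊢ φ ⇔ ψ → Γ ⊢ ψ ⇔ χ → Γ ⊢ φ ⇔ χ
⇔-trans d e = ⇔I (⇔-to (weaken e) (⇔-to (weaken d) hyp₀)) (⇔-from (weaken d) (⇔-from (weaken e) hyp₀))

≐-sym : Γ ⊢ s ≐ t → Γ ⊢ t ≐ s
≐-sym {s = s} {t} = ⇒E (instantiate schema (lookup (s ∷ t ∷ [])))
  where
  schema : [] ⊢ v0 ≐ v1 ⇒ v1 ≐ (v0 {1})
  schema = ⇒I (=E (v0 ≐ v1) hyp₀ (=I v0))

≐-trans : Γ ⊢ s ≐ t → Γ ⊢ t ≐ u → Γ ⊢ s ≐ u
≐-trans {s = s} {t} {u} d = ⇒E (⇒E (instantiate schema (lookup (s ∷ t ∷ u ∷ []))) d)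
  where
  schema : [] ⊢ v0 ≐ v1 ⇒ v1 ≐ v2 ⇒ v0 ≐ (v2 {0})
  schema = ⇒I (⇒I (=E (v1 ≐ v0) hyp₀ hyp₁))

∈-congˡ : Γ ⊢ s ≐ t → Γ ⊢ s ∈' u → Γ ⊢ t ∈' u
∈-congˡ {s = s} {t} {u} d = ⇒E (⇒E (instantiate schema (lookup (s ∷ t ∷ u ∷ []))) d)
  where
  schema : [] ⊢ v0 ≐ v1 ⇒ v0 ∈' v2 ⇒ v1 ∈' (v2 {0})
  schema = ⇒I (⇒I (=E (v0 ∈' v3) hyp₁ hyp₀))

∈-congʳ : Γ ⊢ s ≐ t → Γ ⊢ u ∈' s → Γ ⊢ u ∈' t
∈-congʳ {s = s} {t} {u} d = ⇒E (⇒E (instantiate schema (lookup (s ∷ t ∷ u ∷ []))) d)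
  where
  schema : [] ⊢ v0 ≐ v1 ⇒ v2 ∈' v0 ⇒ v2 ∈' (v1 {1})
  schema = ⇒I (⇒I (=E (v3 ∈' v0) hyp₁ hyp₀))

∈-op-schema : ∀ o → [] ⊢ v0 ∈' app o v2 v1 ⇔ θ {3} o v2 v1 v0
∈-op-schema upair     = ∀E (∀E (∀E (ax (definition upair)) v2) v1) v0
∈-op-schema capBigcap = ∀E (∀E (∀E (ax (definition capBigcap)) v2) v1) v0
∈-op-schema bigUnion  = ∀E (∀E (∀E (ax (definition bigUnion)) v2) v1) v0
∈-op-schema diff      = ∀E (∀E (∀E (ax (definition diff)) v2) v1) v0
∈-op-schema prod      = ∀E (∀E (∀E (ax (definition prod)) v2) v1) v0
∈-op-schema impSep    = ∀E (∀E (∀E (ax (definition impSep)) v2) v1) v0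
∈-op-schema slices    = ∀E (∀E (∀E (ax (definition slices)) v2) v1) v0
∈-op-schema dom       = ∀E (∀E (∀E (ax (definition dom)) v2) v1) v0
∈-op-schema ran       = ∀E (∀E (∀E (ax (definition ran)) v2) v1) v0
∈-op-schema prodR3    = ∀E (∀E (∀E (ax (definition prodR3)) v2) v1) v0
∈-op-schema prodM3    = ∀E (∀E (∀E (ax (definition prodM3)) v2) v1) v0
∈-op-schema diagEq    = ∀E (∀E (∀E (ax (definition diagEq)) v2) v1) v0
∈-op-schema diagMem   = ∀E (∀E (∀E (ax (definition diagMem)) v2) v1) v0

-- For each concrete o the right-hand side computes to θ o x y z.
∈-op : ∀ o (x y z : Term n) → Γ ⊢ z ∈' app o x y ⇔ sub (lookup (z ∷ y ∷ x ∷ [])) (θ o v2 v1 v0)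
∈-op o x y z = instantiate (∈-op-schema o) (lookup (z ∷ y ∷ x ∷ []))

single : Term n → Term n
single a = app upair a a

infixl 9 _×'_
infixl 8 _∩'_ _∪'_ _∖'_

_∩'_ _∪'_ _×'_ _∖'_ : Term n → Term n → Term n
x ∩' y = app capBigcap x (single y)
x ∪' y = app bigUnion (app upair x y) x
x ×' y = app prod x y
x ∖' y = app diff x y

⋃' dom' ran' : Term n → Term n
⋃' x   = app bigUnion x x
dom' x = app dom x x
ran' x = app ran x x

impSep' : Term n → Term n → Term n → Term n
impSep' x a b = app impSep x (opair a b)

∈-upair⁺ˡ : ∀ (a b : Term n) → Γ ⊢ a ∈' app upair a b
∈-upair⁺ˡ a b = ⇔-from (∈-op upair a b a) (∨I₁ (=I a))

∈-upair⁺ʳ : ∀ (a b : Term n) → Γ ⊢ b ∈' app upair a b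
∈-upair⁺ʳ a b = ⇔-from (∈-op upair a b b) (∨I₂ (=I b))

∈-upair⁻ : ∀ {a b u : Term n} → Γ ⊢ u ∈' app upair a b → Γ ⊢ u ≐ a ∨' u ≐ b
∈-upair⁻ {a = a} {b} {u} = ⇔-to (∈-op upair a b u)

∈-single⁻ : ∀ {a u : Term n} → Γ ⊢ u ∈' single a → Γ ⊢ u ≐ a
∈-single⁻ d = ∨E (∈-upair⁻ d) hyp₀ hyp₀

opair-injectiveˡ : ∀ {a b c d : Term n} → Γ ⊢ opair a b ≐ opair c d → Γ ⊢ a ≐ c
opair-injectiveˡ {a = a} {b} {c} {d} e =
  ∨E (∈-upair⁻ (∈-congʳ e (∈-upair⁺ˡ (single a) (app upair a b))))
     (∈-single⁻ (∈-congʳ hyp₀ (∈-upair⁺ˡ a a)))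
     (≐-sym (∈-single⁻ (∈-congʳ (≐-sym hyp₀) (∈-upair⁺ˡ c d))))

-- {c,d} ∈ ⟨a,b⟩ gives d = a or d = b; when d = a, {a,b} ∈ ⟨c,d⟩ gives b = c or b = d,
-- and c = a = d.
opair-injectiveʳ : ∀ {a b c d : Term n} → Γ ⊢ opair a b ≐ opair c d → Γ ⊢ b ≐ d
opair-injectiveʳ {Γ = Γ} {a = a} {b} {c} {d} e = ∨E d≐a∨d≐b (≐-sym (d≐a⇒d≐b hyp₀)) (≐-sym hyp₀)
  where
  a≐c : Γ ⊢ a ≐ c
  a≐c = opair-injectiveˡ e
  d≐a∨d≐b : Γ ⊢ d ≐ a ∨' d ≐ b
  d≐a∨d≐b = ∨E (∈-upair⁻ (∈-congʳ (≐-sym e) (∈-upair⁺ʳ (single c) (app upair c d))))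
               (∨I₁ (∈-single⁻ (∈-congʳ hyp₀ (∈-upair⁺ʳ c d))))
               (∈-upair⁻ (∈-congʳ hyp₀ (∈-upair⁺ʳ c d)))
  d≐a⇒d≐b : (d ≐ a ∷ Γ) ⊢ d ≐ a → (d ≐ a ∷ Γ) ⊢ d ≐ b
  d≐a⇒d≐b da = ≐-sym (∨E (∈-upair⁻ (∈-congʳ (weaken e) (∈-upair⁺ʳ (single a) (app upair a b))))
     (≐-trans (∈-single⁻ (∈-congʳ hyp₀ (∈-upair⁺ʳ a b)))
              (≐-trans (≐-sym (weaken (weaken a≐c))) (≐-sym (weaken da))))
     (∨E (∈-upair⁻ (∈-congʳ hyp₀ (∈-upair⁺ʳ a b)))
         (≐-trans hyp₀ (≐-trans (≐-sym (weaken (weaken (weaken a≐c)))) (≐-sym (weaken (weaken da)))))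
         hyp₀))

opair-cong : ∀ {a b c d : Term n} → Γ ⊢ a ≐ b → Γ ⊢ c ≐ d → Γ ⊢ opair a c ≐ opair b d
opair-cong {a = a} {b} {c} {d} p = ⇒E (⇒E (instantiate schema (lookup (a ∷ b ∷ c ∷ d ∷ []))) p)
  where
  schema : [] ⊢ v0 ≐ v1 ⇒ v2 ≐ v3 ⇒ opair v0 v2 ≐ opair v1 (v3 {0})
  schema = ⇒I (⇒I (=E (opair v1 v3 ≐ opair v2 v0) hyp₀
                      (=E (opair v1 v3 ≐ opair v0 v3) hyp₁ (=I (opair v0 v2)))))

∈-∩⁺ : ∀ {z x y : Term n} → Γ ⊢ z ∈' x → Γ ⊢ z ∈' y → Γ ⊢ z ∈' x ∩' y
∈-∩⁺ {z = z} {x} {y} p = ⇒E (⇒E (instantiate schema (lookup (z ∷ x ∷ y ∷ []))) p)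
  where
  schema : [] ⊢ v0 ∈' v1 ⇒ v0 ∈' v2 ⇒ v0 ∈' v1 ∩' (v2 {0})
  schema = ⇒I (⇒I (⇔-from (∈-op capBigcap v1 (single v2) v0)
                     (∧I hyp₁ (∀I (⇒I (∈-congʳ (≐-sym (∈-single⁻ hyp₀)) hyp₁))))))

∈-∩⁻ˡ : ∀ {z x y : Term n} → Γ ⊢ z ∈' x ∩' y → Γ ⊢ z ∈' x
∈-∩⁻ˡ {z = z} {x} {y} p = ∧E₁ (⇔-to (∈-op capBigcap x (single y) z) p)

∈-∩⁻ʳ : ∀ {z x y : Term n} → Γ ⊢ z ∈' x ∩' y → Γ ⊢ z ∈' y
∈-∩⁻ʳ {z = z} {x} {y} = ⇒E (instantiate schema (lookup (z ∷ x ∷ y ∷ [])))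
  where
  schema : [] ⊢ v0 ∈' v1 ∩' v2 ⇒ v0 ∈' (v2 {0})
  schema = ⇒I (⇒E (∀E (∧E₂ (⇔-to (∈-op capBigcap v1 (single v2) v0) hyp₀)) v2) (∈-upair⁺ˡ v2 v2))

∈-∪⁻ : ∀ {z x y : Term n} → Γ ⊢ z ∈' x ∪' y → Γ ⊢ z ∈' x ∨' z ∈' y
∈-∪⁻ {z = z} {x} {y} = ⇒E (instantiate schema (lookup (z ∷ x ∷ y ∷ [])))
  where
  schema : [] ⊢ v0 ∈' v1 ∪' v2 ⇒ v0 ∈' v1 ∨' v0 ∈' (v2 {0})
  schema = ⇒I (∃E (⇔-to (∈-op bigUnion (app upair v1 v2) v1 v0) hyp₀)
             (∨E (∈-upair⁻ (∧E₁ hyp₀)) (∨I₁ (∈-congʳ hyp₀ (∧E₂ hyp₁))) (∨I₂ (∈-congʳ hyp₀ (∧E₂ hyp₁)))))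

∈-∪⁺ˡ : ∀ {z x y : Term n} → Γ ⊢ z ∈' x → Γ ⊢ z ∈' x ∪' y
∈-∪⁺ˡ {z = z} {x} {y} = ⇒E (instantiate schema (lookup (z ∷ x ∷ y ∷ [])))
  where
  schema : [] ⊢ v0 ∈' v1 ⇒ v0 ∈' v1 ∪' (v2 {0})
  schema = ⇒I (⇔-from (∈-op bigUnion (app upair v1 v2) v1 v0) (∃I v1 (∧I (∈-upair⁺ˡ v1 v2) hyp₀)))

∈-∪⁺ʳ : ∀ {z x y : Term n} → Γ ⊢ z ∈' y → Γ ⊢ z ∈' x ∪' y
∈-∪⁺ʳ {z = z} {x} {y} = ⇒E (instantiate schema (lookup (z ∷ x ∷ y ∷ [])))
  where
  schema : [] ⊢ v0 ∈' v2 ⇒ v0 ∈' v1 ∪' (v2 {0})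
  schema = ⇒I (⇔-from (∈-op bigUnion (app upair v1 v2) v1 v0) (∃I v2 (∧I (∈-upair⁺ʳ v1 v2) hyp₀)))

∈-⋃⁺ : ∀ {z w x : Term n} → Γ ⊢ z ∈' w → Γ ⊢ w ∈' x → Γ ⊢ z ∈' ⋃' x
∈-⋃⁺ {z = z} {w} {x} p = ⇒E (⇒E (instantiate schema (lookup (z ∷ w ∷ x ∷ []))) p)
  where
  schema : [] ⊢ v0 ∈' v1 ⇒ v1 ∈' v2 ⇒ v0 ∈' ⋃' (v2 {0})
  schema = ⇒I (⇒I (⇔-from (∈-op bigUnion v2 v2 v0) (∃I v1 (∧I hyp₀ hyp₁))))

∉-∖-self : ∀ {z x : Term n} → Γ ⊢ z ∈' x ∖' x → Γ ⊢ φ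
∉-∖-self {z = z} {x} p = ⊥E (⇒E (∧E₂ z∈x∖x) (∧E₁ z∈x∖x))
  where z∈x∖x = ⇔-to (∈-op diff x x z) p

∈-×⁺ : ∀ {a b x y : Term n} → Γ ⊢ a ∈' x → Γ ⊢ b ∈' y → Γ ⊢ opair a b ∈' x ×' y
∈-×⁺ {a = a} {b} {x} {y} p = ⇒E (⇒E (instantiate schema (lookup (a ∷ b ∷ x ∷ y ∷ []))) p)
  where
  schema : [] ⊢ v0 ∈' v2 ⇒ v1 ∈' v3 ⇒ opair v0 v1 ∈' v2 ×' (v3 {0})
  schema = ⇒I (⇒I (⇔-from (∈-op prod v2 v3 (opair v0 v1)) (∃I v0 (∃I v1 (∧I hyp₁ (∧I hyp₀ (=I _)))))))

∈-×⁻ : ∀ {a b x y : Term n} → Γ ⊢ opair a b ∈' x ×' y → Γ ⊢ a ∈' x ∧' b ∈' y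
∈-×⁻ {a = a} {b} {x} {y} = ⇒E (instantiate schema (lookup (a ∷ b ∷ x ∷ y ∷ [])))
  where
  schema : [] ⊢ opair v0 v1 ∈' v2 ×' v3 ⇒ v0 ∈' v2 ∧' v1 ∈' (v3 {0})
  schema = ⇒I (∃E (⇔-to (∈-op prod v2 v3 (opair v0 v1)) hyp₀) (∃E hyp₀
     (∧I (∈-congˡ (≐-sym (opair-injectiveˡ (∧E₂ (∧E₂ hyp₀)))) (∧E₁ hyp₀))
         (∈-congˡ (≐-sym (opair-injectiveʳ (∧E₂ (∧E₂ hyp₀)))) (∧E₁ (∧E₂ hyp₀))))))

∈-impSep⁺ : ∀ {z x a b : Term n} → Γ ⊢ z ∈' x → Γ ⊢ z ∈' a ⇒ z ∈' b → Γ ⊢ z ∈' impSep' x a b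
∈-impSep⁺ {z = z} {x} {a} {b} p = ⇒E (⇒E (instantiate schema (lookup (z ∷ x ∷ a ∷ b ∷ []))) p)
  where
  schema : [] ⊢ v0 ∈' v1 ⇒ (v0 ∈' v2 ⇒ v0 ∈' v3) ⇒ v0 ∈' impSep' v1 v2 (v3 {0})
  schema = ⇒I (⇒I (⇔-from (∈-op impSep v1 (opair v2 v3) v0)
                     (∧I hyp₁ (∃I v2 (∃I v3 (∧I (=I _) hyp₀))))))

∈-impSep⁻ˡ : ∀ {z x a b : Term n} → Γ ⊢ z ∈' impSep' x a b → Γ ⊢ z ∈' x
∈-impSep⁻ˡ {z = z} {x} {a} {b} p = ∧E₁ (⇔-to (∈-op impSep x (opair a b) z) p)

∈-impSep⁻ʳ : ∀ {z x a b : Term n} → Γ ⊢ z ∈' impSep' x a b → Γ ⊢ z ∈' a ⇒ z ∈' b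
∈-impSep⁻ʳ {z = z} {x} {a} {b} = ⇒E (instantiate schema (lookup (z ∷ x ∷ a ∷ b ∷ [])))
  where
  schema : [] ⊢ v0 ∈' impSep' v1 v2 v3 ⇒ (v0 ∈' v2 ⇒ v0 ∈' (v3 {0}))
  schema = ⇒I (∃E (∧E₂ (⇔-to (∈-op impSep v1 (opair v2 v3) v0) hyp₀)) (∃E hyp₀
     (⇒I (∈-congʳ (≐-sym (opair-injectiveʳ (∧E₁ hyp₁)))
                  (⇒E (∧E₂ hyp₁) (∈-congʳ (opair-injectiveˡ (∧E₁ hyp₁)) hyp₀))))))

∈-dom⁺ : ∀ {a b x : Term n} → Γ ⊢ opair a b ∈' x → Γ ⊢ a ∈' dom' x
∈-dom⁺ {a = a} {b} {x} = ⇒E (instantiate schema (lookup (a ∷ b ∷ x ∷ [])))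
  where
  schema : [] ⊢ opair v0 v1 ∈' v2 ⇒ v0 ∈' dom' (v2 {0})
  schema = ⇒I (⇔-from (∈-op dom v2 v2 v0) (∃I (opair v0 v1) (∧I hyp₀ (∃I v1 (=I _)))))

∈-ran⁺ : ∀ {a b x : Term n} → Γ ⊢ opair a b ∈' x → Γ ⊢ b ∈' ran' x
∈-ran⁺ {a = a} {b} {x} = ⇒E (instantiate schema (lookup (a ∷ b ∷ x ∷ [])))
  where
  schema : [] ⊢ opair v0 v1 ∈' v2 ⇒ v1 ∈' ran' (v2 {0})
  schema = ⇒I (⇔-from (∈-op ran v2 v2 v1) (∃I (opair v0 v1) (∧I hyp₀ (∃I v0 (=I _)))))

∈-ran⁻ : ∀ {b x : Term n} → Γ ⊢ b ∈' ran' x → Γ ⊢ ∃' (opair v0 (↑ b) ∈' ↑ x)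
∈-ran⁻ {b = b} {x} = ⇒E (instantiate schema (lookup (b ∷ x ∷ [])))
  where
  schema : [] ⊢ v0 ∈' ran' v1 ⇒ ∃' (opair v0 v1 ∈' (v2 {0}))
  schema = ⇒I (∃E (⇔-to (∈-op ran v1 v1 v0) hyp₀) (∃E (∧E₂ hyp₀) (∃I v0 (∈-congˡ hyp₀ (∧E₁ hyp₁)))))

∈-prodR3⁺ : ∀ {u v w x y : Term n} → Γ ⊢ opair u v ∈' x → Γ ⊢ w ∈' y →
            Γ ⊢ triple u v w ∈' app prodR3 x y
∈-prodR3⁺ {u = u} {v} {w} {x} {y} p = ⇒E (⇒E (instantiate schema (lookup (u ∷ v ∷ w ∷ x ∷ y ∷ []))) p)
  where
  schema : [] ⊢ opair v0 v1 ∈' v3 ⇒ v2 ∈' var (# 4) ⇒ triple v0 v1 v2 ∈' app prodR3 v3 (var {5} (# 4))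
  schema = ⇒I (⇒I (⇔-from (∈-op prodR3 _ _ _) (∃I v0 (∃I v1 (∃I v2 (∧I hyp₁ (∧I hyp₀ (=I _))))))))

∈-prodR3⁻ : ∀ {u v w x y : Term n} → Γ ⊢ triple u v w ∈' app prodR3 x y → Γ ⊢ opair u v ∈' x ∧' w ∈' y
∈-prodR3⁻ {u = u} {v} {w} {x} {y} = ⇒E (instantiate schema (lookup (u ∷ v ∷ w ∷ x ∷ y ∷ [])))
  where
  schema : [] ⊢ triple v0 v1 v2 ∈' app prodR3 v3 (var (# 4)) ⇒ opair v0 v1 ∈' v3 ∧' v2 ∈' var {5} (# 4)
  schema = ⇒I (∃E (⇔-to (∈-op prodR3 _ _ _) hyp₀) (∃E hyp₀ (∃E hyp₀
    (∧I (∈-congˡ (opair-cong (≐-sym (opair-injectiveˡ E)) (≐-sym (opair-injectiveˡ (opair-injectiveʳ E)))) (∧E₁ hyp₀))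
        (∈-congˡ (≐-sym (opair-injectiveʳ (opair-injectiveʳ E))) (∧E₁ (∧E₂ hyp₀)))))))
    where E = ∧E₂ (∧E₂ hyp₀)

∈-prodM3⁺ : ∀ {u v w x y : Term n} → Γ ⊢ opair u v ∈' x → Γ ⊢ w ∈' y →
            Γ ⊢ triple u w v ∈' app prodM3 x y
∈-prodM3⁺ {u = u} {v} {w} {x} {y} p = ⇒E (⇒E (instantiate schema (lookup (u ∷ v ∷ w ∷ x ∷ y ∷ []))) p)
  where
  schema : [] ⊢ opair v0 v1 ∈' v3 ⇒ v2 ∈' var (# 4) ⇒ triple v0 v2 v1 ∈' app prodM3 v3 (var {5} (# 4))
  schema = ⇒I (⇒I (⇔-from (∈-op prodM3 _ _ _) (∃I v0 (∃I v1 (∃I v2 (∧I hyp₁ (∧I hyp₀ (=I _))))))))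

∈-prodM3⁻ : ∀ {u v w x y : Term n} → Γ ⊢ triple u w v ∈' app prodM3 x y → Γ ⊢ opair u v ∈' x ∧' w ∈' y
∈-prodM3⁻ {u = u} {v} {w} {x} {y} = ⇒E (instantiate schema (lookup (u ∷ v ∷ w ∷ x ∷ y ∷ [])))
  where
  schema : [] ⊢ triple v0 v2 v1 ∈' app prodM3 v3 (var (# 4)) ⇒ opair v0 v1 ∈' v3 ∧' v2 ∈' var {5} (# 4)
  schema = ⇒I (∃E (⇔-to (∈-op prodM3 _ _ _) hyp₀) (∃E hyp₀ (∃E hyp₀
    (∧I (∈-congˡ (opair-cong (≐-sym (opair-injectiveˡ E)) (≐-sym (opair-injectiveʳ (opair-injectiveʳ E)))) (∧E₁ hyp₀))
        (∈-congˡ (≐-sym (opair-injectiveˡ (opair-injectiveʳ E))) (∧E₁ (∧E₂ hyp₀)))))))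
    where E = ∧E₂ (∧E₂ hyp₀)

∈-diagEq⁺ : ∀ {v u x y : Term n} → Γ ⊢ v ∈' y → Γ ⊢ u ∈' x → Γ ⊢ u ≐ v → Γ ⊢ opair v u ∈' app diagEq x y
∈-diagEq⁺ {v = v} {u} {x} {y} p q = ⇒E (⇒E (⇒E (instantiate schema (lookup (v ∷ u ∷ x ∷ y ∷ []))) p) q)
  where
  schema : [] ⊢ v0 ∈' v3 ⇒ v1 ∈' v2 ⇒ v1 ≐ v0 ⇒ opair v0 v1 ∈' app diagEq v2 (v3 {0})
  schema = ⇒I (⇒I (⇒I (⇔-from (∈-op diagEq _ _ _) (∃I v0 (∃I v1 (∧I hyp₂ (∧I hyp₁ (∧I hyp₀ (=I _)))))))))

∈-diagEq⁻ : ∀ {v u x y : Term n} → Γ ⊢ opair v u ∈' app diagEq x y → Γ ⊢ u ≐ v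
∈-diagEq⁻ {v = v} {u} {x} {y} = ⇒E (instantiate schema (lookup (v ∷ u ∷ x ∷ y ∷ [])))
  where
  schema : [] ⊢ opair v0 v1 ∈' app diagEq v2 v3 ⇒ v1 ≐ (v0 {3})
  schema = ⇒I (∃E (⇔-to (∈-op diagEq _ _ _) hyp₀) (∃E hyp₀
    (≐-trans (opair-injectiveʳ E) (≐-trans (∧E₁ (∧E₂ (∧E₂ hyp₀))) (≐-sym (opair-injectiveˡ E))))))
    where E = ∧E₂ (∧E₂ (∧E₂ hyp₀))

∈-diagMem⁺ : ∀ {v u x y : Term n} → Γ ⊢ v ∈' y → Γ ⊢ u ∈' x → Γ ⊢ u ∈' v → Γ ⊢ opair v u ∈' app diagMem x y
∈-diagMem⁺ {v = v} {u} {x} {y} p q = ⇒E (⇒E (⇒E (instantiate schema (lookup (v ∷ u ∷ x ∷ y ∷ []))) p) q)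
  where
  schema : [] ⊢ v0 ∈' v3 ⇒ v1 ∈' v2 ⇒ v1 ∈' v0 ⇒ opair v0 v1 ∈' app diagMem v2 (v3 {0})
  schema = ⇒I (⇒I (⇒I (⇔-from (∈-op diagMem _ _ _) (∃I v0 (∃I v1 (∧I hyp₂ (∧I hyp₁ (∧I hyp₀ (=I _)))))))))

∈-diagMem⁻ : ∀ {v u x y : Term n} → Γ ⊢ opair v u ∈' app diagMem x y → Γ ⊢ u ∈' v
∈-diagMem⁻ {v = v} {u} {x} {y} = ⇒E (instantiate schema (lookup (v ∷ u ∷ x ∷ y ∷ [])))
  where
  schema : [] ⊢ opair v0 v1 ∈' app diagMem v2 v3 ⇒ v1 ∈' (v0 {3})
  schema = ⇒I (∃E (⇔-to (∈-op diagMem _ _ _) hyp₀) (∃E hyp₀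
    (∈-congʳ (≐-sym (opair-injectiveˡ E)) (∈-congˡ (≐-sym (opair-injectiveʳ E)) (∧E₁ (∧E₂ (∧E₂ hyp₀)))))))
    where E = ∧E₂ (∧E₂ (∧E₂ hyp₀))

∈-slices⁺ : ∀ {w x y z : Term n} → Γ ⊢ w ∈' y → Γ ⊢ ∀' (v0 ∈' ↑ z ⇔ opair (↑ w) v0 ∈' ↑ x) →
            Γ ⊢ z ∈' app slices x y
∈-slices⁺ {w = w} {x} {y} {z} p = ⇒E (⇒E (instantiate schema (lookup (w ∷ x ∷ y ∷ z ∷ []))) p)
  where
  schema : [] ⊢ v0 ∈' v2 ⇒ ∀' (v0 ∈' var (# 4) ⇔ opair v1 v0 ∈' v2) ⇒ v3 ∈' app slices v1 (v2 {1})
  schema = ⇒I (⇒I (⇔-from (∈-op slices _ _ _) (∃I v0 (∧I hyp₁ hyp₀))))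

slice : Term n → Term n → Term n
slice w x = ran' (x ∩' single w ×' ran' x)

∈-slice : ∀ (w x : Term n) → Γ ⊢ ∀' (v0 ∈' ↑ (slice w x) ⇔ opair (↑ w) v0 ∈' ↑ x)
∈-slice w x = instantiate schema (lookup (w ∷ x ∷ []))
  where
  schema : [] ⊢ ∀' (v0 ∈' ↑ (slice v0 v1) ⇔ opair v1 v0 ∈' (v2 {0}))
  schema = ∀I (⇔I
    (∃E (∈-ran⁻ hyp₀) (∈-congˡ (opair-cong (∈-single⁻ (∧E₁ (∈-×⁻ (∈-∩⁻ʳ hyp₀)))) (=I v1)) (∈-∩⁻ˡ hyp₀)))
    (∈-ran⁺ (∈-∩⁺ hyp₀ (∈-×⁺ (∈-upair⁺ˡ v1 v1) (∈-ran⁺ hyp₀)))))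

inst-v0-lift : (χ : Formula (suc n)) → inst (ren (liftR suc) χ) v0 ≡ χ
inst-v0-lift χ = begin
  inst (ren (liftR suc) χ) v0         ≡⟨ inst-as-sub _ v0 ⟩
  sub (instS v0) (ren (liftR suc) χ)  ≡⟨ sub-ren (instS v0) (liftR suc) χ ⟩
  sub (instS v0 ∘ liftR suc) χ        ≡⟨ sub-cong (λ { zero → refl ; (suc i) → refl }) χ ⟩
  sub var χ                           ≡⟨ sub-id χ ⟩
  χ                                   ∎
  where open ≡-Reasoning

∀E-v0 : {Δ : List (Formula (suc n))} {χ : Formula (suc n)} → Δ ⊢ ren suc (∀' χ) → Δ ⊢ χ
∀E-v0 {Δ = Δ} {χ} d = subst (Δ ⊢_) (inst-v0-lift χ) (∀E d v0)

∃I-v0 : {Δ : List (Formula (suc n))} {χ : Formula (suc n)} → Δ ⊢ χ → Δ ⊢ ren suc (∃' χ)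
∃I-v0 {Δ = Δ} {χ} d = ∃I v0 (subst (Δ ⊢_) (sym (inst-v0-lift χ)) d)

Sep : Term n → Term n → Term n → Formula n → Formula n
Sep T D τ φ = τ ∈' T ⇔ τ ∈' D ∧' φ

module _ {τ D T₁ T₂ : Term n} {φ₁ φ₂ : Formula n} where

  Sep-∧ : Γ ⊢ Sep T₁ D τ φ₁ → Γ ⊢ Sep T₂ D τ φ₂ → Γ ⊢ Sep (T₁ ∩' T₂) D τ (φ₁ ∧' φ₂)
  Sep-∧ s₁ s₂ = ⇔I
    (∧I (∧E₁ (⇔-to (weaken s₁) (∈-∩⁻ˡ hyp₀)))
        (∧I (∧E₂ (⇔-to (weaken s₁) (∈-∩⁻ˡ hyp₀))) (∧E₂ (⇔-to (weaken s₂) (∈-∩⁻ʳ hyp₀)))))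
    (∈-∩⁺ (⇔-from (weaken s₁) (∧I (∧E₁ hyp₀) (∧E₁ (∧E₂ hyp₀))))
          (⇔-from (weaken s₂) (∧I (∧E₁ hyp₀) (∧E₂ (∧E₂ hyp₀)))))

  Sep-∨ : Γ ⊢ Sep T₁ D τ φ₁ → Γ ⊢ Sep T₂ D τ φ₂ → Γ ⊢ Sep (T₁ ∪' T₂) D τ (φ₁ ∨' φ₂)
  Sep-∨ s₁ s₂ = ⇔I
    (∨E (∈-∪⁻ hyp₀)
        (∧I (∧E₁ (⇔-to (weaken (weaken s₁)) hyp₀)) (∨I₁ (∧E₂ (⇔-to (weaken (weaken s₁)) hyp₀))))
        (∧I (∧E₁ (⇔-to (weaken (weaken s₂)) hyp₀)) (∨I₂ (∧E₂ (⇔-to (weaken (weaken s₂)) hyp₀)))))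
    (∨E (∧E₂ hyp₀)
        (∈-∪⁺ˡ (⇔-from (weaken (weaken s₁)) (∧I (∧E₁ hyp₁) hyp₀)))
        (∈-∪⁺ʳ (⇔-from (weaken (weaken s₂)) (∧I (∧E₁ hyp₁) hyp₀))))

  Sep-⇒ : Γ ⊢ Sep T₁ D τ φ₁ → Γ ⊢ Sep T₂ D τ φ₂ → Γ ⊢ Sep (impSep' D T₁ T₂) D τ (φ₁ ⇒ φ₂)
  Sep-⇒ s₁ s₂ = ⇔I
    (∧I (∈-impSep⁻ˡ hyp₀)
        (⇒I (∧E₂ (⇔-to (weaken (weaken s₂))
                   (⇒E (∈-impSep⁻ʳ hyp₁) (⇔-from (weaken (weaken s₁)) (∧I (∈-impSep⁻ˡ hyp₁) hyp₀)))))))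
    (∈-impSep⁺ (∧E₁ hyp₀)
        (⇒I (⇔-from (weaken (weaken s₂))
               (∧I (∧E₁ hyp₁) (⇒E (∧E₂ hyp₁) (∧E₂ (⇔-to (weaken (weaken s₁)) hyp₀)))))))

Sep-⊥ : ∀ {τ D : Term n} → Γ ⊢ Sep (D ∖' D) D τ ⊥'
Sep-⊥ = ⇔I (∉-∖-self hyp₀) (⊥E (∧E₂ hyp₀))

AssignsOnly : Term n → Term n → Term n → Formula n
AssignsOnly G τ x = ∀' (opair v0 (↑ τ) ∈' ↑ G ⇒ v0 ≐ ↑ x)

-- With graphs Gᵢ ∋ ⟨xᵢ,τ⟩ and Gⱼ ∋ ⟨xⱼ,τ⟩, `related` consists of the triples ⟨xⱼ,u,τ⟩ with
-- τ ∈ D and u R xⱼ (R the relation of the diagonal operation o); dropping xⱼ, intersecting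
-- with Gᵢ (which forces u = xᵢ) and dropping u leaves the τ with xᵢ R xⱼ.
atom' : Op → Term n → Term n → Term n → Term n
atom' o D Gᵢ Gⱼ = D ∩' ran' (Gᵢ ∩' ran' related)
  where related = app prodR3 (app o (dom' Gᵢ) (dom' Gⱼ)) D ∩' app prodM3 Gⱼ (dom' Gᵢ)

∈-atom⁺ : ∀ {o} {τ D Gᵢ Gⱼ xᵢ xⱼ : Term n} → Γ ⊢ τ ∈' D → Γ ⊢ opair xᵢ τ ∈' Gᵢ → Γ ⊢ opair xⱼ τ ∈' Gⱼ →
          Γ ⊢ opair xⱼ xᵢ ∈' app o (dom' Gᵢ) (dom' Gⱼ) → Γ ⊢ τ ∈' atom' o D Gᵢ Gⱼ
∈-atom⁺ τ∈D xᵢτ∈Gᵢ xⱼτ∈Gⱼ related =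
  ∈-∩⁺ τ∈D (∈-ran⁺ (∈-∩⁺ xᵢτ∈Gᵢ (∈-ran⁺ (∈-∩⁺ (∈-prodR3⁺ related τ∈D) (∈-prodM3⁺ xⱼτ∈Gⱼ (∈-dom⁺ xᵢτ∈Gᵢ))))))

private
  hyp₅ : ∀ {ψ₁ ψ₂ ψ₃ ψ₄ ψ₅ : Formula n} → (ψ₅ ∷ ψ₄ ∷ ψ₃ ∷ ψ₂ ∷ ψ₁ ∷ φ ∷ Γ) ⊢ φ
  hyp₅ = hyp (there (there (there (there (there (here refl))))))

Sep-≐ : ∀ {τ D Gᵢ Gⱼ xᵢ xⱼ : Term n} → Γ ⊢ AssignsOnly Gᵢ τ xᵢ → Γ ⊢ AssignsOnly Gⱼ τ xⱼ →
        Γ ⊢ τ ∈' D ⇒ opair xᵢ τ ∈' Gᵢ → Γ ⊢ τ ∈' D ⇒ opair xⱼ τ ∈' Gⱼ →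
        Γ ⊢ Sep (atom' diagEq D Gᵢ Gⱼ) D τ (xᵢ ≐ xⱼ)
Sep-≐ {τ = τ} {D} {Gᵢ} {Gⱼ} {xᵢ} {xⱼ} a b c d =
  ⇒E (⇒E (⇒E (⇒E (instantiate schema (lookup (τ ∷ D ∷ Gᵢ ∷ Gⱼ ∷ xᵢ ∷ xⱼ ∷ []))) a) b) c) d
  where
  schema : [] ⊢ AssignsOnly v2 v0 (var (# 4)) ⇒ AssignsOnly v3 v0 (var (# 5)) ⇒
                (v0 ∈' v1 ⇒ opair (var (# 4)) v0 ∈' v2) ⇒ (v0 ∈' v1 ⇒ opair (var (# 5)) v0 ∈' v3) ⇒
                Sep (atom' diagEq v1 v2 v3) v1 v0 (var (# 4) ≐ var {6} (# 5))
  schema = ⇒I (⇒I (⇒I (⇒I (⇔I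
    (∧I (∈-∩⁻ˡ hyp₀) (∃E (∈-ran⁻ (∈-∩⁻ʳ hyp₀)) (∃E (∈-ran⁻ (∈-∩⁻ʳ hyp₀))
      (≐-trans (≐-sym (weaken (⊢-wkVar (⇒E (∀E hyp₅ v0) (∈-∩⁻ˡ hyp₀)))))
               (≐-trans (∈-diagEq⁻ (∧E₁ (∈-prodR3⁻ (∈-∩⁻ˡ hyp₀))))
                        (⇒E (∀E hyp₅ v0) (∧E₁ (∈-prodM3⁻ (∈-∩⁻ʳ hyp₀)))))))))
    (∈-atom⁺ (∧E₁ hyp₀) (⇒E hyp₂ (∧E₁ hyp₀)) (⇒E hyp₁ (∧E₁ hyp₀))
      (∈-diagEq⁺ (∈-dom⁺ (⇒E hyp₁ (∧E₁ hyp₀))) (∈-dom⁺ (⇒E hyp₂ (∧E₁ hyp₀))) (∧E₂ hyp₀)))))))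

Sep-∈ : ∀ {τ D Gᵢ Gⱼ xᵢ xⱼ : Term n} → Γ ⊢ AssignsOnly Gᵢ τ xᵢ → Γ ⊢ AssignsOnly Gⱼ τ xⱼ →
        Γ ⊢ τ ∈' D ⇒ opair xᵢ τ ∈' Gᵢ → Γ ⊢ τ ∈' D ⇒ opair xⱼ τ ∈' Gⱼ →
        Γ ⊢ Sep (atom' diagMem D Gᵢ Gⱼ) D τ (xᵢ ∈' xⱼ)
Sep-∈ {τ = τ} {D} {Gᵢ} {Gⱼ} {xᵢ} {xⱼ} a b c d =
  ⇒E (⇒E (⇒E (⇒E (instantiate schema (lookup (τ ∷ D ∷ Gᵢ ∷ Gⱼ ∷ xᵢ ∷ xⱼ ∷ []))) a) b) c) d
  where
  schema : [] ⊢ AssignsOnly v2 v0 (var (# 4)) ⇒ AssignsOnly v3 v0 (var (# 5)) ⇒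
                (v0 ∈' v1 ⇒ opair (var (# 4)) v0 ∈' v2) ⇒ (v0 ∈' v1 ⇒ opair (var (# 5)) v0 ∈' v3) ⇒
                Sep (atom' diagMem v1 v2 v3) v1 v0 (var (# 4) ∈' var {6} (# 5))
  schema = ⇒I (⇒I (⇒I (⇒I (⇔I
    (∧I (∈-∩⁻ˡ hyp₀) (∃E (∈-ran⁻ (∈-∩⁻ʳ hyp₀)) (∃E (∈-ran⁻ (∈-∩⁻ʳ hyp₀))
      (∈-congˡ (weaken (⊢-wkVar (⇒E (∀E hyp₅ v0) (∈-∩⁻ˡ hyp₀))))
               (∈-congʳ (⇒E (∀E hyp₅ v0) (∧E₁ (∈-prodM3⁻ (∈-∩⁻ʳ hyp₀))))
                        (∈-diagMem⁻ (∧E₁ (∈-prodR3⁻ (∈-∩⁻ˡ hyp₀)))))))))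
    (∈-atom⁺ (∧E₁ hyp₀) (⇒E hyp₂ (∧E₁ hyp₀)) (⇒E hyp₁ (∧E₁ hyp₀))
      (∈-diagMem⁺ (∈-dom⁺ (⇒E hyp₁ (∧E₁ hyp₀))) (∈-dom⁺ (⇒E hyp₂ (∧E₁ hyp₀))) (∧E₂ hyp₀)))))))

-- {τ ∈ A : ∀ z ∈ B. ⟨z,τ⟩ ∈ C} as A ∩ ⋂ {C_z : z ∈ B} with C_z = {u : ⟨z,u⟩ ∈ C}.
forallIn' : Term n → Term n → Term n → Term n
forallIn' A B C = app capBigcap A (app slices C B)

∈-forallIn : ∀ (τ A B C : Term n) →
             Γ ⊢ Sep (forallIn' A B C) A τ (∀' (v0 ∈' ↑ B ⇒ opair v0 (↑ τ) ∈' ↑ C))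
∈-forallIn τ A B C = instantiate schema (lookup (τ ∷ A ∷ B ∷ C ∷ []))
  where
  schema : [] ⊢ Sep (forallIn' v1 v2 v3) v1 v0 (∀' (v0 ∈' v3 ⇒ opair v0 v1 ∈' var {5} (# 4)))
  schema = ⇔I
    (∧I (∧E₁ (⇔-to (∈-op capBigcap _ _ _) hyp₀)) (∀I (⇒I
      (⇔-to (∀E (∈-slice v0 (var (# 4))) v1)
            (⇒E (∀E (∧E₂ (⇔-to (∈-op capBigcap _ _ _) hyp₁)) (slice v0 (var (# 4))))
                (∈-slices⁺ hyp₀ (∈-slice v0 (var (# 4)))))))))
    (⇔-from (∈-op capBigcap _ _ _) (∧I (∧E₁ hyp₀) (∀I (⇒I
      (∃E (⇔-to (∈-op slices _ _ _) hyp₀)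
          (⇔-from (∀E (∧E₂ hyp₀) v2) (⇒E (∀E (∧E₂ hyp₂) v0) (∧E₁ hyp₀))))))))

-- If G is total on A with ⟨x,τ⟩ ∈ G, then x ⊆ ⋃ dom G, so a quantifier over ⋃ dom G guarded
-- by z ∈ x is a quantifier over x.
Sep-∀∈ : ∀ {τ A C G x : Term n} {ψ : Formula (suc n)} →
         [] ⊢ Sep (↑ C) (↑ (⋃' (dom' G) ×' A)) (opair v0 (↑ τ)) (v0 ∈' ↑ x ⇒ ψ) →
         [] ⊢ τ ∈' A ⇒ opair x τ ∈' G →
         [] ⊢ Sep (forallIn' A (⋃' (dom' G)) C) A τ (∀' (v0 ∈' ↑ x ⇒ ψ))
Sep-∀∈ {τ = τ} {A} {C} {G} hC total = ⇔-trans (∈-forallIn τ A (⋃' (dom' G)) C) (⇔I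
  (∧I (∧E₁ hyp₀) (∀I (⇒I
    (⇒E (∧E₂ (⇔-to (weaken-[] hC) (⇒E (∀E-v0 (∧E₂ hyp₁))
                                   (∈-⋃⁺ hyp₀ (∈-dom⁺ (⇒E (weaken-[] (⊢-wkVar total)) (∧E₁ hyp₁)))))))
        hyp₀))))
  (∧I (∧E₁ hyp₀) (∀I (⇒I
    (⇔-from (weaken-[] hC) (∧I (∈-×⁺ hyp₀ (∧E₁ hyp₁)) (⇒I (⇒E (∀E-v0 (∧E₂ hyp₂)) hyp₀))))))))

Sep-∃∈ : ∀ {τ A C G x : Term n} {ψ : Formula (suc n)} →
         [] ⊢ Sep (↑ C) (↑ (⋃' (dom' G) ×' A)) (opair v0 (↑ τ)) (v0 ∈' ↑ x ∧' ψ) →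
         [] ⊢ τ ∈' A ⇒ opair x τ ∈' G →
         [] ⊢ Sep (ran' C) A τ (∃' (v0 ∈' ↑ x ∧' ψ))
Sep-∃∈ hC total = ⇔I
  (∃E (∈-ran⁻ hyp₀) (∧I (∧E₂ (∈-×⁻ (∧E₁ (⇔-to (weaken-[] hC) hyp₀))))
                        (∃I-v0 (∧E₂ (⇔-to (weaken-[] hC) hyp₀)))))
  (∃E (∧E₂ hyp₀) (∈-ran⁺ {a = v0} (⇔-from (weaken-[] hC) (∧I
    (∈-×⁺ (∈-⋃⁺ (∧E₁ hyp₀) (∈-dom⁺ (⇒E (weaken-[] (⊢-wkVar total)) (∧E₁ hyp₁)))) (∧E₁ hyp₁))
    hyp₀))))

private
  variable
    p : ℕ

tuple : (k : ℕ) → Term (suc k + n)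
tuple zero    = v0
tuple (suc k) = opair v0 (↑ (tuple k))

↑[_] : (k : ℕ) → Term m → Term (k + m)
↑[ k ] = renT (k ↑ʳ_)

↑-↑[] : (k : ℕ) (T : Term m) → ↑ (↑[ k ] T) ≡ ↑[ suc k ] T
↑-↑[] k = renT-∘ suc (k ↑ʳ_)

-- Terms T, D : Term (suc p) speak about a domain variable (var zero) and p parameters.
-- Separating k T D φ says that a tuple ⟨x₀,…,x_k⟩ of D lies in T iff φ(x₀,…,x_k, params);
-- the k + 1 tuple variables are bound in front of the domain variable, so T and D are
-- weakened by ↑[ suc k ] and φ is embedded by skipDomain (suc k).
skipDomain : (k : ℕ) → Fin (k + p) → Fin (k + suc p)
skipDomain zero    = suc
skipDomain (suc k) = liftR (skipDomain k)

coord : (k : ℕ) → Fin (suc k + p) → Term (suc k + suc p)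
coord k j = var (skipDomain (suc k) j)

Separating : (k : ℕ) → Term (suc p) → Term (suc p) → Formula (suc k + p) → Set
Separating k T D φ = [] ⊢ Sep (↑[ suc k ] T) (↑[ suc k ] D) (tuple k) (ren (skipDomain (suc k)) φ)

-- Graph of the j-th coordinate on a set D of tuples; past the tuple it is a parameter.
proj : (k : ℕ) → Fin (suc k + p) → Term (suc p) → Term (suc p)
proj zero    zero    D = app diagEq D D
proj zero    (suc q) D = single (var (suc q)) ×' D
proj (suc k) zero    D = app prodR3 (app diagEq (dom' D) (dom' D)) (ran' D)
proj (suc k) (suc j) D = app prodM3 (proj k j (ran' D)) (dom' D)

proj-functional : ∀ k (j : Fin (suc k + p)) D →
  [] ⊢ opair v0 (↑ (tuple k)) ∈' ↑ (↑[ suc k ] (proj k j D)) ⇒ v0 ≐ ↑ (coord k j)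
proj-functional zero    zero    D = ⇒I (≐-sym (∈-diagEq⁻ hyp₀))
proj-functional zero    (suc q) D = ⇒I (∈-single⁻ (∧E₁ (∈-×⁻ hyp₀)))
proj-functional (suc k) zero    D = ⇒I (≐-sym (∈-diagEq⁻ (∧E₁ (∈-prodR3⁻ hyp₀))))
proj-functional (suc k) (suc j) D = ⇒I (⇒E (weaken-[] ih) (∧E₁ (∈-prodM3⁻ hyp₀)))
  where
  G = proj k j (ran' D)
  ih : [] ⊢ opair v0 (↑ (↑ (tuple k))) ∈' ↑ (↑[ suc (suc k) ] G) ⇒ v0 ≐ ↑ (↑ (coord k j))
  ih = subst₂ (λ τ G′ → [] ⊢ opair v0 τ ∈' G′ ⇒ v0 ≐ ↑ (↑ (coord k j)))
         (renT-wk suc (tuple k)) (trans (renT-wk suc (↑[ suc k ] G)) (cong ↑ (↑-↑[] (suc k) G)))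
         (⊢-ren (proj-functional k j (ran' D)) (liftR suc) λ ())

proj-total : ∀ k (j : Fin (suc k + p)) D →
  [] ⊢ tuple k ∈' ↑[ suc k ] D ⇒ opair (coord k j) (tuple k) ∈' ↑[ suc k ] (proj k j D)
proj-total zero    zero    D = ⇒I (∈-diagEq⁺ hyp₀ hyp₀ (=I v0))
proj-total zero    (suc q) D = ⇒I (∈-×⁺ (∈-upair⁺ˡ _ _) hyp₀)
proj-total (suc k) zero    D = ⇒I (∈-prodR3⁺ (∈-diagEq⁺ (∈-dom⁺ hyp₀) (∈-dom⁺ hyp₀) (=I v0)) (∈-ran⁺ hyp₀))
proj-total (suc k) (suc j) D = ⇒I (∈-prodM3⁺ (⇒E (weaken-[] ih) (∈-ran⁺ hyp₀)) (∈-dom⁺ hyp₀))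
  where
  G = proj k j (ran' D)
  ih : [] ⊢ ↑ (tuple k) ∈' ran' (↑[ suc (suc k) ] D) ⇒
            opair (↑ (coord k j)) (↑ (tuple k)) ∈' ↑[ suc (suc k) ] G
  ih = subst₂ (λ D′ G′ → [] ⊢ ↑ (tuple k) ∈' ran' D′ ⇒ opair (↑ (coord k j)) (↑ (tuple k)) ∈' G′)
         (↑-↑[] (suc k) D) (↑-↑[] (suc k) G) (⊢-wkVar (proj-total k j (ran' D)))

atomTerm : Op → (k : ℕ) → (i j : Fin (suc k + p)) → Term (suc p)
atomTerm o k i j = atom' o v0 (proj k i v0) (proj k j v0)

Separating-∈ : ∀ k (i j : Fin (suc k + p)) → Separating k (atomTerm diagMem k i j) v0 (var i ∈' var j)
Separating-∈ k i j =
  Sep-∈ (∀I (proj-functional k i v0)) (∀I (proj-functional k j v0)) (proj-total k i v0) (proj-total k j v0)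

Separating-≐ : ∀ k (i j : Fin (suc k + p)) → Separating k (atomTerm diagEq k i j) v0 (var i ≐ var j)
Separating-≐ k i j =
  Sep-≐ (∀I (proj-functional k i v0)) (∀I (proj-functional k j v0)) (proj-total k i v0) (proj-total k j v0)

replaceDomain : Term (suc p) → Fin (suc p) → Term (suc p)
replaceDomain B zero    = B
replaceDomain B (suc q) = var (suc q)

liftS* : (k : ℕ) → (Fin m → Term n) → Fin (k + m) → Term (k + n)
liftS* zero    σ = σ
liftS* (suc k) σ = liftS (liftS* k σ)

liftS*-tuple : ∀ k (σ : Fin m → Term n) → subT (liftS* (suc k) σ) (tuple k) ≡ tuple k
liftS*-tuple zero    σ = refl
liftS*-tuple (suc k) σ = cong (opair v0) (begin
  subT (liftS* (suc (suc k)) σ) (↑ (tuple k))  ≡⟨ subT-renT (liftS* (suc (suc k)) σ) suc (tuple k) ⟩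
  subT (↑ ∘ liftS* (suc k) σ) (tuple k)         ≡⟨ sym (renT-subT suc (liftS* (suc k) σ) (tuple k)) ⟩
  ↑ (subT (liftS* (suc k) σ) (tuple k))         ≡⟨ cong ↑ (liftS*-tuple k σ) ⟩
  ↑ (tuple k)                                   ∎)
  where open ≡-Reasoning

liftS*-↑ʳ : ∀ k (σ : Fin m → Term n) i → liftS* k σ (k ↑ʳ i) ≡ ↑[ k ] (σ i)
liftS*-↑ʳ zero    σ i = sym (renT-id (σ i))
liftS*-↑ʳ (suc k) σ i = trans (cong ↑ (liftS*-↑ʳ k σ i)) (↑-↑[] k (σ i))

subT-liftS*-↑[] : ∀ k (σ : Fin m → Term n) T → subT (liftS* k σ) (↑[ k ] T) ≡ ↑[ k ] (subT σ T)
subT-liftS*-↑[] k σ T =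
  trans (subT-renT (liftS* k σ) (k ↑ʳ_) T)
        (trans (subT-cong (liftS*-↑ʳ k σ) T) (sym (renT-subT (k ↑ʳ_) σ T)))

liftS*-skipDomain : ∀ k (B : Term (suc p)) j → liftS* k (replaceDomain B) (skipDomain k j) ≡ var (skipDomain k j)
liftS*-skipDomain zero    B j       = refl
liftS*-skipDomain (suc k) B zero    = refl
liftS*-skipDomain (suc k) B (suc j) = cong ↑ (liftS*-skipDomain k B j)

sub-replaceDomain-skipDomain : ∀ k (B : Term (suc p)) φ →
  sub (liftS* k (replaceDomain B)) (ren (skipDomain k) φ) ≡ ren (skipDomain k) φ
sub-replaceDomain-skipDomain k B φ =
  trans (sub-ren _ (skipDomain k) φ)
        (trans (sub-cong (liftS*-skipDomain k B) φ) (sym (ren-as-sub (skipDomain k) φ)))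

Separating-replaceDomain : ∀ {k} {T : Term (suc p)} {φ} B →
  Separating k T v0 φ → Separating k (subT (replaceDomain B) T) B φ
Separating-replaceDomain {k = k} {T} {φ} B sep =
  subst ([] ⊢_) (cong₂ _⇔_ (cong₂ _∈'_ tuple≡ T≡) (cong₂ _∧'_ (cong₂ _∈'_ tuple≡ D≡) φ≡))
        (⊢-sub sep σ λ ())
  where
  σ = liftS* (suc k) (replaceDomain B)
  tuple≡ = liftS*-tuple k (replaceDomain B)
  T≡ = subT-liftS*-↑[] (suc k) (replaceDomain B) T
  D≡ = liftS*-↑ʳ (suc k) (replaceDomain B) zero
  φ≡ = sub-replaceDomain-skipDomain (suc k) B φ

bound : (k : ℕ) → Fin (suc k + p) → Term (suc p)
bound k j = ⋃' (dom' (proj k j v0))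

Separating-under : ∀ k {T G : Term (suc p)} {χ} → Separating (suc k) T (⋃' (dom' G) ×' v0) χ →
  [] ⊢ Sep (↑ (↑[ suc k ] T)) (↑ (⋃' (dom' (↑[ suc k ] G)) ×' ↑[ suc k ] v0))
           (opair v0 (↑ (tuple k))) (ren (skipDomain (suc (suc k))) χ)
Separating-under k {T} {G} {χ} =
  subst₂ (λ T′ G′ → [] ⊢ Sep T′ (⋃' (dom' G′) ×' ↑[ suc (suc k) ] v0) (tuple (suc k)) (ren (skipDomain (suc (suc k))) χ))
         (sym (↑-↑[] (suc k) T)) (sym (↑-↑[] (suc k) G))

Separating-∀∈ : ∀ k (j : Fin (suc k + p)) {T ψ} →
  Separating (suc k) T (bound k j ×' v0) (v0 ∈' var (suc j) ⇒ ψ) →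
  Separating k (forallIn' v0 (bound k j) T) v0 (∀' (v0 ∈' var (suc j) ⇒ ψ))
Separating-∀∈ k j sep = Sep-∀∈ (Separating-under k sep) (proj-total k j v0)

Separating-∃∈ : ∀ k (j : Fin (suc k + p)) {T ψ} →
  Separating (suc k) T (bound k j ×' v0) (v0 ∈' var (suc j) ∧' ψ) →
  Separating k (ran' T) v0 (∃' (v0 ∈' var (suc j) ∧' ψ))
Separating-∃∈ k j sep = Sep-∃∈ (Separating-under k sep) (proj-total k j v0)

separatingTerm : (k : ℕ) {φ : Formula (suc k + p)} → IsΣ0 φ → Term (suc p)
separatingTerm k (mem i j)  = atomTerm diagMem k i j
separatingTerm k (eq i j)   = atomTerm diagEq k i j
separatingTerm k bot        = v0 ∖' v0
separatingTerm k (and d e)  = separatingTerm k d ∩' separatingTerm k e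
separatingTerm k (or d e)   = separatingTerm k d ∪' separatingTerm k e
separatingTerm k (imp d e)  = impSep' v0 (separatingTerm k d) (separatingTerm k e)
separatingTerm k (ball j d) =
  forallIn' v0 (bound k j)
    (subT (replaceDomain (bound k j ×' v0)) (impSep' v0 (atomTerm diagMem (suc k) zero (suc j)) (separatingTerm (suc k) d)))
separatingTerm k (bex j d)  =
  ran' (subT (replaceDomain (bound k j ×' v0)) (atomTerm diagMem (suc k) zero (suc j) ∩' separatingTerm (suc k) d))

separatingTerm-separates : ∀ k {φ : Formula (suc k + p)} (d : IsΣ0 φ) → Separating k (separatingTerm k d) v0 φ
separatingTerm-separates k (mem i j)  = Separating-∈ k i j
separatingTerm-separates k (eq i j)   = Separating-≐ k i j
separatingTerm-separates k bot        = Sep-⊥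
separatingTerm-separates k (and d e)  = Sep-∧ (separatingTerm-separates k d) (separatingTerm-separates k e)
separatingTerm-separates k (or d e)   = Sep-∨ (separatingTerm-separates k d) (separatingTerm-separates k e)
separatingTerm-separates k (imp d e)  = Sep-⇒ (separatingTerm-separates k d) (separatingTerm-separates k e)
separatingTerm-separates k (ball j d) =
  Separating-∀∈ k j (Separating-replaceDomain (bound k j ×' v0)
    (Sep-⇒ (Separating-∈ (suc k) zero (suc j)) (separatingTerm-separates (suc k) d)))
separatingTerm-separates k (bex j d)  =
  Separating-∃∈ k j (Separating-replaceDomain (bound k j ×' v0)
    (Sep-∧ (Separating-∈ (suc k) zero (suc j)) (separatingTerm-separates (suc k) d)))

IsΣ0-ren : (ρ : Fin m → Fin n) {φ : Formula m} → IsΣ0 φ → IsΣ0 (ren ρ φ)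
IsΣ0-ren ρ (mem i j)  = mem (ρ i) (ρ j)
IsΣ0-ren ρ (eq i j)   = eq (ρ i) (ρ j)
IsΣ0-ren ρ bot        = bot
IsΣ0-ren ρ (and d e)  = and (IsΣ0-ren ρ d) (IsΣ0-ren ρ e)
IsΣ0-ren ρ (or d e)   = or (IsΣ0-ren ρ d) (IsΣ0-ren ρ e)
IsΣ0-ren ρ (imp d e)  = imp (IsΣ0-ren ρ d) (IsΣ0-ren ρ e)
IsΣ0-ren ρ (ball j d) = ball (ρ j) (IsΣ0-ren (liftR ρ) d)
IsΣ0-ren ρ (bex j d)  = bex (ρ j) (IsΣ0-ren (liftR ρ) d)

toFront : Fin (suc m) → Fin (suc m) → Fin (suc m)
toFront i j with i ≟ j
... | yes _  = zero
... | no i≢j = suc (punchOut i≢j)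

skipDomain-toFront : (i j : Fin (suc m)) → skipDomain 1 (toFront i j) ≡ sepRen i j
skipDomain-toFront i j with i ≟ j
... | yes _ = refl
... | no _  = refl

mainTheorem6 : ∀ {m : ℕ} (φ : Formula (suc m)) → IsΣ0 φ → (i : Fin (suc m)) →
    Σ[ G ∈ Term (suc m) ] ⊢IKP (SepEq G φ i)
mainTheorem6 φ d i = G , ∀I (subst (λ ψ → [] ⊢ Sep (↑ G) v1 v0 ψ) moved (separatingTerm-separates 0 d′))
  where
  d′ = IsΣ0-ren (toFront i) d
  G = separatingTerm 0 d′
  moved : ren (skipDomain 1) (ren (toFront i) φ) ≡ ren (sepRen i) φ
  moved = trans (ren-∘ (skipDomain 1) (toFront i) φ) (ren-cong (skipDomain-toFront i) φ)
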